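{- Let $(G,F)$ be a framed graph and $e=(i,j)$ an inner edge of $G$. Then the split map $\Phi_e$ is a surjection from the set of maximal cliques of $(G,F)$ onto the set of maximal cliques of $(M(G,e),F_e)$.
   Context: A flow graph $G$ is a finite directed acyclic multigraph with linearly ordered vertices, edges directed from smaller to larger vertices, a unique source $s$ and unique sink $t$; a route is a directed $s$–$t$ path. A framing $F$ gives at each vertex $v$ linear orders $\le_{\mathrm{In}(v)}$, $\le_{\mathrm{Out}(v)}$ on entering and leaving edges. For a path $P$ through $v$, $Pv$ (resp. $vP$) is the maximal subpath of $P$ ending (resp. starting) at $v$. For $Pv,Qv$, let $w$ be the first vertex after which they coincide; if $w$ is the first vertex of one of them they are equal, else $Pv<_{\mathscr I(v)}Qv$ iff $P$'s edge entering $w$ precedes $Q$'s in $\le_{\mathrm{In}(w)}$. Dually for $vP,vQ$ with $w'$ the last vertex before which they coincide, using $\le_{\mathrm{Out}(w')}$, giving $<_{\mathscr O(v)}$. Paths with common inner vertex $v$ are incoherent at $v$ if either ($Pv<_{\mathscr I(v)}Qv$ and $vQ<_{\mathscr O(v)}vP$) or ($Qv<_{\mathscr I(v)}Pv$ and $vP<_{\mathscr O(v)}vQ$), and coherent if incoherent at no common inner vertex. A clique is a set of pairwise coherent routes; maximal cliques are maximal under inclusion. An edge $e=(i,j)$ is inner if $i,j\notin\{s,t\}$. $M(G,e)$ is obtained from $G$ by replacing $e$ with edges $e_s=(s,j)$ and $e_t=(i,t)$; its framing $F_e$ is inherited from $F$, with $e_s$ in the position of $e$ in $\le_{\mathrm{In}(j)}$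 and $e_t$ in the position of $e$ in $\le_{\mathrm{Out}(i)}$ (positions at $s,t$ arbitrary). For a route $R$ of $G$, $\varphi_e(R)=\{R\}$ if $e\notin R$ and $\varphi_e(R)=\{e_s\cup jR,\ Ri\cup e_t\}$ if $e\in R$; for a set $A$ of routes, $\Phi_e(A)=\bigcup_{R\in A}\varphi_e(R)$. -}

module Defs where

open import Data.Nat using (ℕ; suc) renaming (_<_ to _<ℕ_)
open import Data.Fin using (Fin; zero; suc; _<_; _≟_)
open import Data.List using (List; []; _∷_; _++_; map; reverse; concatMap)
open import Data.List.Membership.Propositional using (_∈_)
open import Data.List.Relation.Unary.All using (All)
open import Data.List.Relation.Unary.Any using (Any)
open import Data.Product using (Σ; ∃; _×_; _,_)
open import Data.Sum using (_⊎_)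
open import Data.Empty using (⊥)
open import Data.Bool using (if_then_else_)
open import Relation.Nullary using (¬_; yes; no; does)
open import Relation.Binary.PropositionalEquality using (_≡_; _≢_)
open import Function.Bundles using (_⇔_)
import Data.List.Membership.DecPropositional as DecMem

record Graph : Set where
  field
    n   : ℕ
    m   : ℕ
    src : Fin m → Fin n
    tgt : Fin m → Fin n
    s   : Fin n
    t   : Fin n

open Graph public

-- G is a flow graph: acyclic with edges directed from smaller to larger
-- vertices, s is the unique source, t is the unique sink.
record IsFlowGraph (G : Graph) : Set where
  field
    increasing : ∀ a → src G a < tgt G a
    s-source   : ∀ a → tgt G a ≢ s G
    s-unique   : ∀ v → v ≢ s G → ∃ λ a → tgt G a ≡ v
    t-sink     : ∀ a → src G a ≢ t G
    t-unique   : ∀ v → v ≢ t G → ∃ λ a → src G a ≡ v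

-- A linear order on the finite set In(v) is represented by a ranking
-- which is injective on In(v):  a ≤_In(v) b  iff  inRank a ≤ inRank b.
record Framing (G : Graph) : Set where
  field
    inRank     : Fin (m G) → ℕ
    outRank    : Fin (m G) → ℕ
    inRank-inj  : ∀ a b → tgt G a ≡ tgt G b → inRank a ≡ inRank b → a ≡ b
    outRank-inj : ∀ a b → src G a ≡ src G b → outRank a ≡ outRank b → a ≡ b

open Framing public

module _ (G : Graph) where

  data Walk : Fin (n G) → Fin (n G) → List (Fin (m G)) → Set where
    nil  : ∀ {u} → Walk u u []
    cons : ∀ {u w a as} → src G a ≡ u → Walk (tgt G a) w as → Walk u w (a ∷ as)

  IsRoute : List (Fin (m G)) → Set
  IsRoute P = Walk (s G) (t G) P

  InnerVertex : List (Fin (m G)) → Fin (n G) → Set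
  InnerVertex P v = Any (λ a → tgt G a ≡ v) P × Any (λ a → src G a ≡ v) P

  upTo : Fin (n G) → List (Fin (m G)) → List (Fin (m G))
  upTo v [] = []
  upTo v (a ∷ as) with tgt G a ≟ v
  ... | yes _ = a ∷ []
  ... | no  _ = a ∷ upTo v as

  from : Fin (n G) → List (Fin (m G)) → List (Fin (m G))
  from v [] = []
  from v (a ∷ as) with src G a ≟ v
  ... | yes _ = a ∷ as
  ... | no  _ = from v as

  module _ (F : Framing G) where

    -- comparison of two paths read backwards from their common end v:
    -- strip the common part (which ends at w); if one of them is used
    -- up they are equal, otherwise compare the edges entering w.
    inLtRev : List (Fin (m G)) → List (Fin (m G)) → Set
    inLtRev [] _ = ⊥
    inLtRev (_ ∷ _) [] = ⊥
    inLtRev (a ∷ as) (b ∷ bs) with a ≟ b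
    ... | yes _ = inLtRev as bs
    ... | no  _ = inRank F a <ℕ inRank F b

    InLt : Fin (n G) → List (Fin (m G)) → List (Fin (m G)) → Set
    InLt v P Q = inLtRev (reverse (upTo v P)) (reverse (upTo v Q))

    outLtFwd : List (Fin (m G)) → List (Fin (m G)) → Set
    outLtFwd [] _ = ⊥
    outLtFwd (_ ∷ _) [] = ⊥
    outLtFwd (a ∷ as) (b ∷ bs) with a ≟ b
    ... | yes _ = outLtFwd as bs
    ... | no  _ = outRank F a <ℕ outRank F b

    OutLt : Fin (n G) → List (Fin (m G)) → List (Fin (m G)) → Set
    OutLt v P Q = outLtFwd (from v P) (from v Q)

    Incoherent : Fin (n G) → List (Fin (m G)) → List (Fin (m G)) → Set
    Incoherent v P Q = (InLt v P Q × OutLt v Q P) ⊎ (InLt v Q P × OutLt v P Q)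

    Coherent : List (Fin (m G)) → List (Fin (m G)) → Set
    Coherent P Q = ∀ v → InnerVertex P v → InnerVertex Q v → ¬ Incoherent v P Q

    IsClique : List (List (Fin (m G))) → Set
    IsClique A = All IsRoute A × (∀ P Q → P ∈ A → Q ∈ A → Coherent P Q)

    IsMaxClique : List (List (Fin (m G))) → Set
    IsMaxClique A = IsClique A × (∀ B → IsClique B → (∀ {R} → R ∈ A → R ∈ B) → ∀ {R} → R ∈ B → R ∈ A)

_≋_ : ∀ {X : Set} → List X → List X → Set
A ≋ B = (∀ {R} → R ∈ A → R ∈ B) × (∀ {R} → R ∈ B → R ∈ A)

InnerEdge : (G : Graph) → Fin (m G) → Set
InnerEdge G e = src G e ≢ s G × src G e ≢ t G × tgt G e ≢ s G × tgt G e ≢ t G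

-- The graph M(G,e).  Edges of M(G,e) are Fin (suc m):
--   zero    is e_s = (s, j)
--   suc e   is e_t = (i, t)
--   suc k   (k ≢ e) is the original edge k.

M : (G : Graph) → Fin (m G) → Graph
M G e = record
  { n = n G
  ; m = suc (m G)
  ; src = srcM
  ; tgt = tgtM
  ; s = s G
  ; t = t G
  }
  where
  srcM : Fin (suc (m G)) → Fin (n G)
  srcM zero = s G
  srcM (suc k) = src G k
  tgtM : Fin (suc (m G)) → Fin (n G)
  tgtM zero = tgt G e
  tgtM (suc k) = if does (k ≟ e) then t G else tgt G k

e-s : ∀ {k} → Fin (suc k)
e-s = zero

e-t : ∀ {k} → Fin k → Fin (suc k)
e-t e = suc e

orig : (G : Graph) → Fin (m G) → Fin (suc (m G)) → Fin (m G)
orig G e zero = e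
orig G e (suc k) = k

-- F' is a framing F_e of M(G,e) inherited from F: e_s takes the position
-- of e in In(j), e_t the position of e in Out(i), all other comparisons
-- are those of F; the positions of e_t in In(t) and of e_s in Out(s)
-- are arbitrary.
record Inherits (G : Graph) (F : Framing G) (e : Fin (m G)) (F' : Framing (M G e)) : Set where
  field
    in-inherit : ∀ a b → tgt (M G e) a ≡ tgt (M G e) b → a ≢ e-t e → b ≢ e-t e →
                 (inRank F' a <ℕ inRank F' b) ⇔ (inRank F (orig G e a) <ℕ inRank F (orig G e b))
    out-inherit : ∀ a b → src (M G e) a ≡ src (M G e) b → a ≢ e-s → b ≢ e-s →
                 (outRank F' a <ℕ outRank F' b) ⇔ (outRank F (orig G e a) <ℕ outRank F (orig G e b))

φ : (G : Graph) (e : Fin (m G)) → List (Fin (m G)) → List (List (Fin (suc (m G))))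
φ G e R with DecMem._∈?_ _≟_ e R
... | yes _ = (e-s ∷ map suc (from G (tgt G e) R))
            ∷ (map suc (upTo G (src G e) R) ++ (e-t e ∷ []))
            ∷ []
... | no  _ = map suc R ∷ []

Φ : (G : Graph) (e : Fin (m G)) → List (List (Fin (m G))) → List (List (Fin (suc (m G))))
Φ G e A = concatMap (φ G e) A

module Submission where

-- Routes of M(G,e) are the lifts of the routes of G avoiding e and the two pieces e_s ∪ jR,
-- Ri ∪ e_t of the routes R through e.  As F_e is inherited from F, comparing pieces at a vertex
-- compares the routes they come from, cut at i or j; so Φ_e maps cliques to cliques, and a route
-- of G is coherent with a clique A as soon as its pieces are coherent with Φ_e(A) and, at i, it
-- does not cross the routes of A through e.
-- Conversely, let B ⊇ Φ_e(A) be a clique and suppose A saturated: it contains every route that is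
-- coherent with A and whose pieces are coherent with B.  Then every Y ∈ B is a piece of a route of
-- A.  A piece e_s ∪ Q is completed by the part before i of a route of A through e, chosen by a
-- staircase argument so that the completion crosses none of them at i; if A has no route through
-- e, the part before i is built backwards from i, entering each vertex by an edge that crosses no
-- route of B there.  Pieces Ri ∪ e_t are completed dually, and A absorbs the completions.
-- Maximal cliques are saturated.  Hence Φ_e(A) is maximal when A is, and a maximal B equals
-- Φ_e(A) for A the greedily built maximal clique of routes whose pieces lie in B.

module Lexicographic where

  open import Data.Nat using (ℕ) renaming (_<_ to _<ℕ_)
  open import Data.Nat.Properties using (<-trans; <-irrefl) renaming (_<?_ to _<ℕ?_)
  open import Data.Fin using (Fin; _≟_)
  open import Data.List using (List; []; _∷_; _++_; map)
  open import Data.List.Membership.Propositional using (_∉_)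
  open import Data.List.Relation.Unary.All using (All; []; _∷_)
  open import Data.List.Relation.Unary.Any using (here; there)
  open import Data.Product using (_×_; _,_; proj₁; proj₂)
  open import Data.Sum using (_⊎_; inj₁; inj₂)
  open import Data.Empty using (⊥; ⊥-elim)
  open import Function.Bundles using (_⇔_; mk⇔; Equivalence)
  open import Relation.Nullary using (¬_; yes; no; Dec)
  open import Relation.Binary.PropositionalEquality using (_≡_; _≢_; refl)

  module LexOrder {k : ℕ} (rank : Fin k → ℕ) where

    Lex : List (Fin k) → List (Fin k) → Set
    Lex [] _ = ⊥
    Lex (_ ∷ _) [] = ⊥
    Lex (a ∷ x) (b ∷ y) with a ≟ b
    ... | yes _ = Lex x y
    ... | no  _ = rank a <ℕ rank b

    Lex-∷⁻ : ∀ a x y → Lex (a ∷ x) (a ∷ y) → Lex x y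
    Lex-∷⁻ a x y p with a ≟ a
    ... | yes _ = p
    ... | no a≢a = ⊥-elim (a≢a refl)

    Lex-∷⁺ : ∀ a x y → Lex x y → Lex (a ∷ x) (a ∷ y)
    Lex-∷⁺ a x y p with a ≟ a
    ... | yes _ = p
    ... | no a≢a = ⊥-elim (a≢a refl)

    Lex-head⁻ : ∀ {a b} x y → a ≢ b → Lex (a ∷ x) (b ∷ y) → rank a <ℕ rank b
    Lex-head⁻ {a} {b} x y a≢b p with a ≟ b
    ... | yes a≡b = ⊥-elim (a≢b a≡b)
    ... | no _ = p

    Lex-head⁺ : ∀ {a b} x y → a ≢ b → rank a <ℕ rank b → Lex (a ∷ x) (b ∷ y)
    Lex-head⁺ {a} {b} x y a≢b p with a ≟ b
    ... | yes a≡b = ⊥-elim (a≢b a≡b)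
    ... | no _ = p

    Lex-irrefl : ∀ x → ¬ Lex x x
    Lex-irrefl [] ()
    Lex-irrefl (a ∷ x) p = Lex-irrefl x (Lex-∷⁻ a x x p)

    Lex-trans : ∀ x y z → Lex x y → Lex y z → Lex x z
    Lex-trans [] y z () q
    Lex-trans (a ∷ x) [] z () q
    Lex-trans (a ∷ x) (b ∷ y) [] p ()
    Lex-trans (a ∷ x) (b ∷ y) (c ∷ z) p q with a ≟ b | b ≟ c
    Lex-trans (a ∷ x) (.a ∷ y) (.a ∷ z) p q | yes refl | yes refl = Lex-∷⁺ a x z (Lex-trans x y z p q)
    Lex-trans (a ∷ x) (.a ∷ y) (c ∷ z) p q | yes refl | no a≢c with a ≟ c
    ... | yes a≡c = ⊥-elim (a≢c a≡c)
    ... | no _ = q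
    Lex-trans (a ∷ x) (b ∷ y) (.b ∷ z) p q | no a≢b | yes refl with a ≟ b
    ... | yes a≡b = ⊥-elim (a≢b a≡b)
    ... | no _ = p
    Lex-trans (a ∷ x) (b ∷ y) (c ∷ z) p q | no _ | no _ with a ≟ c
    ... | yes refl = ⊥-elim (<-irrefl refl (<-trans p q))
    ... | no _ = <-trans p q

    Lex? : ∀ x y → Dec (Lex x y)
    Lex? [] y = no (λ ())
    Lex? (a ∷ x) [] = no (λ ())
    Lex? (a ∷ x) (b ∷ y) with a ≟ b
    ... | yes _ = Lex? x y
    ... | no _ = rank a <ℕ? rank b

    Lex-++ : ∀ x y u v → Lex x y → Lex (x ++ u) (y ++ v)
    Lex-++ [] y u v ()
    Lex-++ (a ∷ x) [] u v ()
    Lex-++ (a ∷ x) (b ∷ y) u v p with a ≟ b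
    ... | yes _ = Lex-++ x y u v p
    ... | no _ = p

    Lex-++ˡ : ∀ c x y → Lex x y → Lex (c ++ x) (c ++ y)
    Lex-++ˡ [] x y p = p
    Lex-++ˡ (a ∷ c) x y p = Lex-∷⁺ a (c ++ x) (c ++ y) (Lex-++ˡ c x y p)

    Lex-truncateˡ : ∀ a x z y → a ∉ y → Lex (x ++ a ∷ z) y → Lex (x ++ a ∷ []) y
    Lex-truncateˡ a [] z [] a∉y ()
    Lex-truncateˡ a (c ∷ x) z [] a∉y ()
    Lex-truncateˡ a [] z (b ∷ y) a∉y p with a ≟ b
    ... | yes refl = ⊥-elim (a∉y (here refl))
    ... | no _ = p
    Lex-truncateˡ a (c ∷ x) z (b ∷ y) a∉y p with c ≟ b
    ... | yes _ = Lex-truncateˡ a x z y (λ m → a∉y (there m)) p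
    ... | no _ = p

    Lex-truncateʳ : ∀ a x z y → a ∉ y → Lex y (x ++ a ∷ z) → Lex y (x ++ a ∷ [])
    Lex-truncateʳ a [] z (b ∷ y) a∉y p with b ≟ a
    ... | yes refl = ⊥-elim (a∉y (here refl))
    ... | no _ = p
    Lex-truncateʳ a (c ∷ x) z (b ∷ y) a∉y p with b ≟ c
    ... | yes _ = Lex-truncateʳ a x z y (λ m → a∉y (there m)) p
    ... | no _ = p

    Lex-split : ∀ a x z x′ z′ → a ∉ x → a ∉ x′ → Lex (x ++ a ∷ z) (x′ ++ a ∷ z′) →
                Lex (x ++ a ∷ []) (x′ ++ a ∷ []) ⊎ (x ≡ x′ × Lex z z′)
    Lex-split a [] z [] z′ _ _ p = inj₂ (refl , Lex-∷⁻ a z z′ p)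
    Lex-split a [] z (b ∷ x′) z′ _ a∉x′ p with a ≟ b
    ... | yes refl = ⊥-elim (a∉x′ (here refl))
    ... | no _ = inj₁ p
    Lex-split a (c ∷ x) z [] z′ a∉x _ p with c ≟ a
    ... | yes refl = ⊥-elim (a∉x (here refl))
    ... | no _ = inj₁ p
    Lex-split a (c ∷ x) z (b ∷ x′) z′ a∉x a∉x′ p with c ≟ b
    ... | no _ = inj₁ p
    ... | yes refl with Lex-split a x z x′ z′ (λ m → a∉x (there m)) (λ m → a∉x′ (there m)) p
    ...   | inj₁ q = inj₁ q
    ...   | inj₂ (refl , q) = inj₂ (refl , q)

  -- P relates the entries at every position up to the first one where the lists differ.
  data Aligned {A : Set} (P : A → A → Set) : List A → List A → Set where
    []ˡ : ∀ {l} → Aligned P [] l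
    []ʳ : ∀ {a as} → Aligned P (a ∷ as) []
    _∷_ : ∀ {a b as bs} → P a b → (a ≡ b → Aligned P as bs) → Aligned P (a ∷ as) (b ∷ bs)

  Aligned-map : ∀ {A : Set} {P Q : A → A → Set} → (∀ {a b} → P a b → Q a b) →
                ∀ {l l′} → Aligned P l l′ → Aligned Q l l′
  Aligned-map f []ˡ = []ˡ
  Aligned-map f []ʳ = []ʳ
  Aligned-map f (p ∷ rest) = f p ∷ (λ eq → Aligned-map f (rest eq))

  Aligned-All : ∀ {A : Set} {P : A → A → Set} {B : A → Set} {l l′} → All B l → All B l′ →
                Aligned P l l′ → Aligned (λ a b → P a b × B a × B b) l l′
  Aligned-All _ _ []ˡ = []ˡ
  Aligned-All _ _ []ʳ = []ʳ
  Aligned-All (ba ∷ bl) (bb ∷ bl′) (p ∷ rest) = (p , ba , bb) ∷ (λ eq → Aligned-All bl bl′ (rest eq))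

  module LexMap {k k′ : ℕ} (rank : Fin k → ℕ) (rank′ : Fin k′ → ℕ) (f : Fin k → Fin k′) where
    private
      module L  = LexOrder rank
      module L′ = LexOrder rank′

    Faithful : Fin k → Fin k → Set
    Faithful a b = (f a ≡ f b → a ≡ b) × (rank a <ℕ rank b ⇔ rank′ (f a) <ℕ rank′ (f b))

    Lex-map⁺ : ∀ x y → Aligned Faithful x y → L.Lex x y → L′.Lex (map f x) (map f y)
    Lex-map⁺ [] y _ ()
    Lex-map⁺ (a ∷ x) [] _ ()
    Lex-map⁺ (a ∷ x) (b ∷ y) (g ∷ rest) p with a ≟ b | f a ≟ f b
    ... | yes a≡b | yes _ = Lex-map⁺ x y (rest a≡b) p
    ... | yes refl | no fa≢fb = ⊥-elim (fa≢fb refl)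
    ... | no a≢b | yes fa≡fb = ⊥-elim (a≢b (proj₁ g fa≡fb))
    ... | no _ | no _ = Equivalence.to (proj₂ g) p

    Lex-map⁻ : ∀ x y → Aligned Faithful x y → L′.Lex (map f x) (map f y) → L.Lex x y
    Lex-map⁻ [] y _ ()
    Lex-map⁻ (a ∷ x) [] _ ()
    Lex-map⁻ (a ∷ x) (b ∷ y) (g ∷ rest) p with a ≟ b | f a ≟ f b
    ... | yes a≡b | yes _ = Lex-map⁻ x y (rest a≡b) p
    ... | yes refl | no fa≢fb = ⊥-elim (fa≢fb refl)
    ... | no a≢b | yes fa≡fb = ⊥-elim (a≢b (proj₁ g fa≡fb))
    ... | no _ | no _ = Equivalence.from (proj₂ g) p

    Lex-map : ∀ x y → Aligned Faithful x y → L.Lex x y ⇔ L′.Lex (map f x) (map f y)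
    Lex-map x y al = mk⇔ (Lex-map⁺ x y al) (Lex-map⁻ x y al)

module Staircase where

  open import Data.List using (List; []; _∷_; filter)
  open import Data.List.Membership.Propositional using (_∈_)
  open import Data.List.Membership.Propositional.Properties using (∈-filter⁺; ∈-filter⁻)
  open import Data.List.Relation.Unary.Any using (here; there)
  open import Data.Product using (Σ-syntax; _×_; _,_)
  open import Data.Sum using (_⊎_; inj₁; inj₂)
  open import Relation.Nullary using (¬_; yes; no; Dec)
  open import Relation.Binary.PropositionalEquality using (_≡_; refl; sym; subst)

  module Extremum {A X : Set} (f : A → X) {_<_ : X → X → Set}
                  (<-trans : ∀ {a b c} → a < b → b < c → a < c) (<-irrefl : ∀ {a} → ¬ a < a)
                  (_<?_ : ∀ a b → Dec (a < b)) where

    maximum : ∀ c cs → Σ[ m ∈ A ] m ∈ c ∷ cs × (∀ b → b ∈ c ∷ cs → ¬ f m < f b)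
    maximum c [] = c , here refl , λ { b (here refl) → <-irrefl ; b (there ()) }
    maximum c (d ∷ ds) with maximum d ds
    ... | m , m∈ , m-max with f m <? f c
    ... | yes m<c = c , here refl , λ { b (here refl) → <-irrefl ; b (there b∈) c<b → m-max b b∈ (<-trans m<c c<b) }
    ... | no m≮c = m , there m∈ , λ { b (here refl) → m≮c ; b (there b∈) → m-max b b∈ }

    minimum : ∀ c cs → Σ[ m ∈ A ] m ∈ c ∷ cs × (∀ b → b ∈ c ∷ cs → ¬ f b < f m)
    minimum c [] = c , here refl , λ { b (here refl) → <-irrefl ; b (there ()) }
    minimum c (d ∷ ds) with minimum d ds
    ... | m , m∈ , m-min with f c <? f m
    ... | yes c<m = c , here refl , λ { b (here refl) → <-irrefl ; b (there b∈) b<c → m-min b b∈ (<-trans b<c c<m) }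
    ... | no c≮m = m , there m∈ , λ { b (here refl) → c≮m ; b (there b∈) → m-min b b∈ }

  module Plane {X Y : Set} (_<₁_ : X → X → Set) (_<₂_ : Y → Y → Set) where

    Crosses : X → Y → X → Y → Set
    Crosses x y x′ y′ = (x <₁ x′ × y′ <₂ y) ⊎ (x′ <₁ x × y <₂ y′)

    Crosses-cong : ∀ {x₁ x₂ y₁ y₂ x₁′ x₂′ y₁′ y₂′} →
                   x₁ ≡ x₂ → y₁ ≡ y₂ → x₁′ ≡ x₂′ → y₁′ ≡ y₂′ →
                   Crosses x₁ y₁ x₁′ y₁′ → Crosses x₂ y₂ x₂′ y₂′
    Crosses-cong refl refl refl refl c = c

    module _ {A : Set} (px : A → X) (py : A → Y)
             (<₁-trans : ∀ {a b c} → a <₁ b → b <₁ c → a <₁ c) (<₁-irrefl : ∀ {a} → ¬ a <₁ a)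
             (_<₁?_ : ∀ a b → Dec (a <₁ b))
             (<₂-trans : ∀ {a b c} → a <₂ b → b <₂ c → a <₂ c) (_<₂?_ : ∀ a b → Dec (a <₂ b)) where

      -- Take the px-largest member below height y, or else the px-smallest member.
      uncrossed-at : ∀ a₀ as → (∀ a b → a ∈ a₀ ∷ as → b ∈ a₀ ∷ as → ¬ Crosses (px a) (py a) (px b) (py b)) →
                     ∀ y →
                     Σ[ a ∈ A ] a ∈ a₀ ∷ as × (∀ b → b ∈ a₀ ∷ as → ¬ Crosses (px a) y (px b) (py b))
      uncrossed-at a₀ as noncrossing y with filter (λ b → py b <₂? y) (a₀ ∷ as) in below
      ... | c ∷ cs with Extremum.maximum px <₁-trans <₁-irrefl _<₁?_ c cs
      ...   | m , m∈ , m-max with ∈-filter⁻ (λ b → py b <₂? y) {xs = a₀ ∷ as} (subst (m ∈_) (sym below) m∈)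
      ...     | m∈as , m<y = m , m∈as , uncrossed
        where
        uncrossed : ∀ b → b ∈ a₀ ∷ as → ¬ Crosses (px m) y (px b) (py b)
        uncrossed b b∈ (inj₁ (m<b , b<y)) = m-max b (subst (b ∈_) below (∈-filter⁺ (λ b → py b <₂? y) b∈ b<y)) m<b
        uncrossed b b∈ (inj₂ (b<m , y<b)) = noncrossing m b m∈as b∈ (inj₂ (b<m , <₂-trans m<y y<b))
      uncrossed-at a₀ as noncrossing y | [] with Extremum.minimum px <₁-trans <₁-irrefl _<₁?_ a₀ as
      ... | m , m∈ , m-min = m , m∈ , uncrossed
        where
        uncrossed : ∀ b → b ∈ a₀ ∷ as → ¬ Crosses (px m) y (px b) (py b)
        uncrossed b b∈ (inj₁ (m<b , b<y)) with subst (b ∈_) below (∈-filter⁺ (λ b → py b <₂? y) b∈ b<y)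
        ... | ()
        uncrossed b b∈ (inj₂ (b<m , y<b)) = m-min b b∈ b<m

  Crosses-transpose : ∀ {X Y : Set} (_<₁_ : X → X → Set) (_<₂_ : Y → Y → Set) x y x′ y′ →
                      Plane.Crosses _<₁_ _<₂_ x y x′ y′ → Plane.Crosses _<₂_ _<₁_ y x y′ x′
  Crosses-transpose _ _ _ _ _ _ (inj₁ (x<x′ , y′<y)) = inj₂ (y′<y , x<x′)
  Crosses-transpose _ _ _ _ _ _ (inj₂ (x′<x , y<y′)) = inj₁ (y<y′ , x′<x)

module GreedySubfamily where

  open import Data.List using (List; []; _∷_)
  open import Data.List.Membership.Propositional using (_∈_)
  open import Data.List.Relation.Unary.All using (All; []; _∷_; all?; lookup; tabulate)
  open import Data.List.Relation.Unary.Any using (here; there)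
  open import Data.Product using (_×_; _,_)
  open import Data.Empty using (⊥-elim)
  open import Relation.Nullary using (yes; no; Dec)
  open import Relation.Nullary.Decidable using (_×-dec_)
  open import Relation.Binary.PropositionalEquality using (refl)

  module Greedy {A : Set} (Good : A → Set) (good? : ∀ x → Dec (Good x))
                (_~_ : A → A → Set) (_~?_ : ∀ x y → Dec (x ~ y))
                (~-refl : ∀ {x} → x ~ x) (~-sym : ∀ {x y} → x ~ y → y ~ x) where

    Compatible : List A → Set
    Compatible xs = All Good xs × (∀ x y → x ∈ xs → y ∈ xs → x ~ y)

    extend : List A → List A → List A
    extend acc [] = acc
    extend acc (z ∷ zs) with good? z ×-dec all? (z ~?_) acc
    ... | yes _ = extend (z ∷ acc) zs
    ... | no _ = extend acc zs

    extend-compatible : ∀ acc zs → Compatible acc → Compatible (extend acc zs)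
    extend-compatible acc [] compatible = compatible
    extend-compatible acc (z ∷ zs) (good , pairwise) with good? z ×-dec all? (z ~?_) acc
    ... | no _ = extend-compatible acc zs (good , pairwise)
    ... | yes (z-good , z~acc) = extend-compatible (z ∷ acc) zs (z-good ∷ good , pairwise′)
      where
      pairwise′ : ∀ x y → x ∈ z ∷ acc → y ∈ z ∷ acc → x ~ y
      pairwise′ x y (here refl) (here refl) = ~-refl
      pairwise′ x y (here refl) (there y∈) = lookup z~acc y∈
      pairwise′ x y (there x∈) (here refl) = ~-sym (lookup z~acc x∈)
      pairwise′ x y (there x∈) (there y∈) = pairwise x y x∈ y∈

    extend-⊇ : ∀ acc zs {x} → x ∈ acc → x ∈ extend acc zs
    extend-⊇ acc [] x∈ = x∈
    extend-⊇ acc (z ∷ zs) x∈ with good? z ×-dec all? (z ~?_) acc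
    ... | yes _ = extend-⊇ (z ∷ acc) zs (there x∈)
    ... | no _ = extend-⊇ acc zs x∈

    extend-maximal : ∀ acc zs z → z ∈ zs → Good z → (∀ y → y ∈ extend acc zs → z ~ y) → z ∈ extend acc zs
    extend-maximal acc (z′ ∷ zs) z z∈ z-good z~ with good? z′ ×-dec all? (z′ ~?_) acc
    extend-maximal acc (z′ ∷ zs) z (here refl) z-good z~ | yes _ = extend-⊇ (z ∷ acc) zs (here refl)
    extend-maximal acc (z′ ∷ zs) z (there z∈) z-good z~ | yes _ = extend-maximal (z′ ∷ acc) zs z z∈ z-good z~
    extend-maximal acc (z′ ∷ zs) z (here refl) z-good z~ | no rejected =
      ⊥-elim (rejected (z-good , tabulate (λ {y} y∈ → z~ y (extend-⊇ acc zs y∈))))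
    extend-maximal acc (z′ ∷ zs) z (there z∈) z-good z~ | no _ = extend-maximal acc zs z z∈ z-good z~

    greedy : List A → List A
    greedy = extend []

    greedy-compatible : ∀ zs → Compatible (greedy zs)
    greedy-compatible zs = extend-compatible [] zs ([] , λ x y ())

    greedy-maximal : ∀ zs z → z ∈ zs → Good z → (∀ y → y ∈ greedy zs → z ~ y) → z ∈ greedy zs
    greedy-maximal = extend-maximal []

module Walks where

  open import Data.Nat.Properties using (<-trans; <-irrefl; ≤-refl; <⇒≤; <-≤-trans)
  open import Data.Fin using (Fin; _≟_; _<_; _≤_)
  open import Data.List using (List; []; _∷_; _++_; reverse)
  open import Data.List.Properties using (unfold-reverse; reverse-++)
  open import Data.List.Membership.Propositional using (_∈_)
  open import Data.List.Relation.Unary.Any as Any using (Any; here; there)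
  open import Data.List.Relation.Unary.Any.Properties using (++⁺ˡ; ++⁺ʳ)
  open import Data.Product using (Σ-syntax; _×_; _,_; proj₁; proj₂)
  open import Data.Empty using (⊥-elim)
  open import Relation.Nullary using (¬_; yes; no)
  open import Relation.Binary.PropositionalEquality using (_≡_; _≢_; refl; sym; trans; cong; subst)
  open import Defs
  open Lexicographic using (Aligned; []ˡ; []ʳ; _∷_)

  module _ {H : Graph} {P : Fin (m H) → Set} where

    Any-upTo⁻ : ∀ v l → Any P (upTo H v l) → Any P l
    Any-upTo⁻ v (a ∷ l) p with tgt H a ≟ v
    Any-upTo⁻ v (a ∷ l) (here q) | yes _ = here q
    Any-upTo⁻ v (a ∷ l) (here q) | no _ = here q
    Any-upTo⁻ v (a ∷ l) (there p) | no _ = there (Any-upTo⁻ v l p)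

    Any-from⁻ : ∀ v l → Any P (from H v l) → Any P l
    Any-from⁻ v [] p = p
    Any-from⁻ v (a ∷ l) p with src H a ≟ v
    ... | yes _ = p
    ... | no _ = there (Any-from⁻ v l p)

  module Monotone (H : Graph) (increasing : ∀ a → src H a < tgt H a) where
    E : Set
    E = Fin (m H)

    V : Set
    V = Fin (n H)

    Enters : V → E → Set
    Enters v a = tgt H a ≡ v
    Leaves : V → E → Set
    Leaves v a = src H a ≡ v

    lt-ne : ∀ {x y : V} → x < y → x ≢ y
    lt-ne p refl = <-irrefl refl p

    walk-≤ : ∀ {u w l} → Walk H u w l → u ≤ w
    walk-≤ nil = ≤-refl
    walk-≤ (cons {a = a} refl wk) = <⇒≤ (<-≤-trans (increasing a) (walk-≤ wk))

    entered-inside : ∀ {u w l v} → Walk H u w l → Any (Enters v) l → u < v × v ≤ w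
    entered-inside (cons {a = a} refl wk) (here refl) = increasing a , walk-≤ wk
    entered-inside (cons {a = a} refl wk) (there p) with entered-inside wk p
    ... | q , r = <-trans (increasing a) q , r

    left-inside : ∀ {u w l v} → Walk H u w l → Any (Leaves v) l → u ≤ v × v < w
    left-inside (cons {a = a} refl wk) (here refl) = ≤-refl , <-≤-trans (increasing a) (walk-≤ wk)
    left-inside (cons {a = a} refl wk) (there p) with left-inside wk p
    ... | q , r = <⇒≤ (<-≤-trans (increasing a) q) , r

    walk-++ : ∀ {u v w l r} → Walk H u v l → Walk H v w r → Walk H u w (l ++ r)
    walk-++ nil wr = wr
    walk-++ (cons x wl) wr = cons x (walk-++ wl wr)

    walk-++⁻ : ∀ {u w} l {r} → Walk H u w (l ++ r) → Σ[ v ∈ V ] Walk H u v l × Walk H v w r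
    walk-++⁻ [] wk = _ , nil , wk
    walk-++⁻ (a ∷ l) (cons x wk) with walk-++⁻ l wk
    ... | v , w1 , w2 = v , cons x w1 , w2

    from-own-start : ∀ {v w l} → Walk H v w l → from H v l ≡ l
    from-own-start nil = refl
    from-own-start {v} (cons {a = a} x wk) with src H a ≟ v
    ... | yes _ = refl
    ... | no ne = ⊥-elim (ne x)

    walk-< : ∀ {x y l} → Walk H x y l → x ≢ y → x < y
    walk-< nil ne = ⊥-elim (ne refl)
    walk-< (cons {a = c} refl wk) ne = <-≤-trans (increasing c) (walk-≤ wk)

    upTo-own-end : ∀ {u v l} → Walk H u v l → u < v → upTo H v l ≡ l
    upTo-own-end nil u<v = ⊥-elim (<-irrefl refl u<v)
    upTo-own-end {v = v} (cons {a = a} refl wk) u<v with tgt H a ≟ v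
    upTo-own-end {v = v} (cons {a = a} refl nil) u<v | yes _ = refl
    upTo-own-end {v = v} (cons {a = a} refl (cons {a = b} y wk)) u<v | yes eq =
      ⊥-elim (<-irrefl refl (<-≤-trans (subst (λ z → z < tgt H b) (trans y eq) (increasing b)) (walk-≤ wk)))
    ... | no ne = cong (a ∷_) (upTo-own-end wk (walk-< wk ne))

    upTo-walk : ∀ {u w l v} → Walk H u w l → Any (Enters v) l → Walk H u v (upTo H v l)
    upTo-walk {v = v} (cons {a = a} x wk) p with tgt H a ≟ v
    ... | yes eq = cons x (subst (λ z → Walk H z v []) (sym eq) nil)
    upTo-walk {v = v} (cons {a = a} x wk) (here q) | no ne = ⊥-elim (ne q)
    upTo-walk {v = v} (cons {a = a} x wk) (there p) | no ne = cons x (upTo-walk wk p)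

    upTo-++-from : ∀ {u w l v} → Walk H u w l → Any (Enters v) l → l ≡ upTo H v l ++ from H v l
    upTo-++-from {v = v} (cons {a = a} x wk) p with tgt H a ≟ v | src H a ≟ v
    upTo-++-from {v = v} (cons {a = a} x wk) p | yes refl | yes eq = ⊥-elim (lt-ne (increasing a) eq)
    upTo-++-from {v = v} (cons {a = a} x wk) p | yes refl | no _ = cong (a ∷_) (sym (from-own-start wk))
    upTo-++-from {v = v} (cons {a = a} x wk) (here q) | no ne | _ = ⊥-elim (ne q)
    upTo-++-from {v = v} (cons {a = a} refl wk) (there p) | no ne | yes refl =
      ⊥-elim (<-irrefl refl (<-trans (increasing a) (proj₁ (entered-inside wk p))))
    upTo-++-from {v = v} (cons {a = a} x wk) (there p) | no ne | no _ = cong (a ∷_) (upTo-++-from wk p)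

    from-walk : ∀ {u w l v} → Walk H u w l → Any (Enters v) l → Walk H v w (from H v l)
    from-walk {u} {w} {l} {v} wk p with walk-++⁻ (upTo H v l) (subst (Walk H u w) (upTo-++-from wk p) wk)
    ... | z , w1 , w2 = subst (λ q → Walk H q w (from H v l)) (walk-end-unique w1 (upTo-walk wk p)) w2
      where
      walk-end-unique : ∀ {x y y′ l} → Walk H x y l → Walk H x y′ l → y ≡ y′
      walk-end-unique nil nil = refl
      walk-end-unique (cons _ a) (cons _ b) = walk-end-unique a b

    upTo-++-hit : ∀ v l r → Any (Enters v) l → upTo H v (l ++ r) ≡ upTo H v l
    upTo-++-hit v (a ∷ l) r p with tgt H a ≟ v
    ... | yes _ = refl
    upTo-++-hit v (a ∷ l) r (here q) | no ne = ⊥-elim (ne q)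
    upTo-++-hit v (a ∷ l) r (there p) | no ne = cong (a ∷_) (upTo-++-hit v l r p)

    upTo-++-miss : ∀ v l r → ¬ Any (Enters v) l → upTo H v (l ++ r) ≡ l ++ upTo H v r
    upTo-++-miss v [] r _ = refl
    upTo-++-miss v (a ∷ l) r np with tgt H a ≟ v
    ... | yes q = ⊥-elim (np (here q))
    ... | no ne = cong (a ∷_) (upTo-++-miss v l r (λ z → np (there z)))

    from-++-hit : ∀ v l r → Any (Leaves v) l → from H v (l ++ r) ≡ from H v l ++ r
    from-++-hit v (a ∷ l) r p with src H a ≟ v
    ... | yes _ = refl
    from-++-hit v (a ∷ l) r (here q) | no ne = ⊥-elim (ne q)
    from-++-hit v (a ∷ l) r (there p) | no ne = from-++-hit v l r p

    from-++-miss : ∀ v l r → ¬ Any (Leaves v) l → from H v (l ++ r) ≡ from H v r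
    from-++-miss v [] r _ = refl
    from-++-miss v (a ∷ l) r np with src H a ≟ v
    ... | yes q = ⊥-elim (np (here q))
    ... | no ne = from-++-miss v l r (λ z → np (there z))

    from-∷-miss : ∀ v a as → src H a ≢ v → from H v (a ∷ as) ≡ from H v as
    from-∷-miss v a as ne with src H a ≟ v
    ... | yes q = ⊥-elim (ne q)
    ... | no _ = refl

    upTo-∷-miss : ∀ v a as → tgt H a ≢ v → upTo H v (a ∷ as) ≡ a ∷ upTo H v as
    upTo-∷-miss v a as ne with tgt H a ≟ v
    ... | yes q = ⊥-elim (ne q)
    ... | no _ = refl

    upTo-∷-hit : ∀ v a as → tgt H a ≡ v → upTo H v (a ∷ as) ≡ a ∷ []
    upTo-∷-hit v a as eq with tgt H a ≟ v
    ... | yes _ = refl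
    ... | no ne = ⊥-elim (ne eq)

    data ReverseWalk : V → V → List E → Set where
      rnil : ∀ {v} → ReverseWalk v v []
      rcons : ∀ {v u a as} → tgt H a ≡ v → ReverseWalk (src H a) u as → ReverseWalk v u (a ∷ as)

    reverse-walk-∷ʳ : ∀ {v w l a} → ReverseWalk v w l → tgt H a ≡ w → ReverseWalk v (src H a) (l ++ a ∷ [])
    reverse-walk-∷ʳ rnil refl = rcons refl rnil
    reverse-walk-∷ʳ (rcons x r) eq = rcons x (reverse-walk-∷ʳ r eq)

    reverse-walk : ∀ {u v l} → Walk H u v l → ReverseWalk v u (reverse l)
    reverse-walk nil = rnil
    reverse-walk {l = a ∷ as} (cons refl wk) rewrite unfold-reverse a as = reverse-walk-∷ʳ (reverse-walk wk) refl

    reverse-walks-aligned : ∀ {v u u' l l2} → ReverseWalk v u l → ReverseWalk v u' l2 → Aligned (λ a b → tgt H a ≡ tgt H b) l l2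
    reverse-walks-aligned rnil _ = []ˡ
    reverse-walks-aligned (rcons x r) rnil = []ʳ
    reverse-walks-aligned (rcons x r) (rcons y r2) = trans x (sym y) ∷ (λ { refl → reverse-walks-aligned r r2 })

    walks-aligned : ∀ {u w w' l l2} → Walk H u w l → Walk H u w' l2 → Aligned (λ a b → src H a ≡ src H b) l l2
    walks-aligned nil _ = []ˡ
    walks-aligned (cons x r) nil = []ʳ
    walks-aligned (cons x r) (cons y r2) = trans x (sym y) ∷ (λ { refl → walks-aligned r r2 })

    walk-[] : ∀ {u w} → Walk H u w [] → u ≡ w
    walk-[] nil = refl

    loop-empty : ∀ {u l} → Walk H u u l → l ≡ []
    loop-empty nil = refl
    loop-empty (cons {a = a} refl wk) = ⊥-elim (<-irrefl refl (<-≤-trans (increasing a) (walk-≤ wk)))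

    end-not-left : ∀ {u v l} → Walk H u v l → ¬ Any (Leaves v) l
    end-not-left wk p = <-irrefl refl (proj₂ (left-inside wk p))

    not-entered-beyond : ∀ {u v l y} → Walk H u v l → v < y → ¬ Any (Enters y) l
    not-entered-beyond wk lt p = <-irrefl refl (<-≤-trans lt (proj₂ (entered-inside wk p)))

    not-left-beyond : ∀ {u v l y} → Walk H u v l → v ≤ y → ¬ Any (Leaves y) l
    not-left-beyond wk le p = <-irrefl refl (<-≤-trans (proj₂ (left-inside wk p)) le)

    end-entered : ∀ {u v l} → Walk H u v l → u < v → Any (Enters v) l
    end-entered nil lt = ⊥-elim (<-irrefl refl lt)
    end-entered {v = v} (cons {a = a} x wk) lt with tgt H a ≟ v
    ... | yes q = here q
    ... | no ne = there (end-entered wk (walk-< wk ne))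

    start-left : ∀ {u v l} → Walk H u v l → u < v → Any (Leaves u) l
    start-left nil lt = ⊥-elim (<-irrefl refl lt)
    start-left (cons x wk) lt = here x

    record Split (u w : V) (R : List E) : Set where
      constructor split
      field
        pre       : List E
        edge      : E
        post      : List E
        route≡    : R ≡ pre ++ edge ∷ post
        pre-walk  : Walk H u (src H edge) pre
        post-walk : Walk H (tgt H edge) w post

    open Split public

    split-at-entry : ∀ {u w X v} → Walk H u w X → Any (Enters v) X → Σ[ σ ∈ Split u w X ] tgt H (edge σ) ≡ v
    split-at-entry (cons {a = a} refl wk) (here refl) = split [] a _ refl nil wk , refl
    split-at-entry (cons {a = a} refl wk) (there p) with split-at-entry wk p
    ... | split Y x Z refl wY wZ , ex = split (a ∷ Y) x Z refl (cons refl wY) wZ , ex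

    split-at-exit : ∀ {u w X v} → Walk H u w X → Any (Leaves v) X → Σ[ σ ∈ Split u w X ] src H (edge σ) ≡ v
    split-at-exit (cons {a = a} refl wk) (here refl) = split [] a _ refl nil wk , refl
    split-at-exit (cons {a = a} refl wk) (there p) with split-at-exit wk p
    ... | split Y x Z refl wY wZ , ex = split (a ∷ Y) x Z refl (cons refl wY) wZ , ex

    upTo-entry : ∀ {u w R v} (σ : Split u w R) → tgt H (edge σ) ≡ v → upTo H v R ≡ pre σ ++ edge σ ∷ []
    upTo-entry (split Y x Z refl wY wZ) refl =
      trans (upTo-++-miss (tgt H x) Y (x ∷ Z) (not-entered-beyond wY (increasing x)))
            (cong (Y ++_) (upTo-∷-hit (tgt H x) x Z refl))

    reverse-upTo-entry : ∀ {u w R v} (σ : Split u w R) → tgt H (edge σ) ≡ v →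
                         reverse (upTo H v R) ≡ edge σ ∷ reverse (pre σ)
    reverse-upTo-entry σ ev = trans (cong reverse (upTo-entry σ ev)) (reverse-++ (pre σ) (edge σ ∷ []))

    from-entry : ∀ {u w R v} (σ : Split u w R) → tgt H (edge σ) ≡ v → from H v R ≡ post σ
    from-entry (split Y x Z refl wY wZ) refl =
      trans (from-++-miss (tgt H x) Y (x ∷ Z) (not-left-beyond wY (<⇒≤ (increasing x))))
            (trans (from-∷-miss (tgt H x) x Z (lt-ne (increasing x))) (from-own-start wZ))

    inner-entry : ∀ {u w R v} (σ : Split u w R) → tgt H (edge σ) ≡ v → v < w → InnerVertex H R v
    inner-entry (split Y x Z refl wY wZ) refl lt = ++⁺ʳ Y (here refl) , ++⁺ʳ Y (there (start-left wZ lt))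

    enters-at-entry : ∀ {u w R v} (σ : Split u w R) → tgt H (edge σ) ≡ v → Any (Enters v) R
    enters-at-entry (split Y x Z refl wY wZ) refl = ++⁺ʳ Y (here refl)

    upTo-exit : ∀ {u w R v} (σ : Split u w R) → src H (edge σ) ≡ v → u < v → upTo H v R ≡ pre σ
    upTo-exit (split Y x Z refl wY wZ) refl lt =
      trans (upTo-++-hit (src H x) Y (x ∷ Z) (end-entered wY lt)) (upTo-own-end wY lt)

    from-exit : ∀ {u w R v} (σ : Split u w R) → src H (edge σ) ≡ v → from H v R ≡ edge σ ∷ post σ
    from-exit (split Y x Z refl wY wZ) refl =
      trans (from-++-miss (src H x) Y (x ∷ Z) (end-not-left wY)) (from-own-start (cons refl wZ))

    inner-exit : ∀ {u w R v} (σ : Split u w R) → src H (edge σ) ≡ v → u < v → InnerVertex H R v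
    inner-exit (split Y x Z refl wY wZ) refl lt = ++⁺ˡ (end-entered wY lt) , ++⁺ʳ Y (here refl)

    leaves-at-exit : ∀ {u w R v} (σ : Split u w R) → src H (edge σ) ≡ v → Any (Leaves v) R
    leaves-at-exit (split Y x Z refl wY wZ) refl = ++⁺ʳ Y (here refl)

    split-at : ∀ {u w R a} → Walk H u w R → a ∈ R → Σ[ σ ∈ Split u w R ] edge σ ≡ a
    split-at (cons {a = a} refl wk) (here refl) = split [] a _ refl nil wk , refl
    split-at (cons {a = a} refl wk) (there p) with split-at wk p
    ... | split Y x Z refl wY wZ , ex = split (a ∷ Y) x Z refl (cons refl wY) wZ , ex

module FramingOrders where

  open import Data.Fin using (Fin; _≟_)
  open import Data.Fin.Properties using (all?)
  open import Data.List using (List; []; _∷_; reverse)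
  open import Data.List.Membership.Propositional using (_∈_)
  open import Data.List.Relation.Unary.All using (_∷_)
  open import Data.List.Relation.Unary.Any using (here; there; any?)
  open import Data.Product using (_×_; _,_)
  open import Data.Sum using (inj₁; inj₂)
  open import Relation.Nullary using (yes; no; Dec)
  open import Relation.Nullary.Decidable using (_×-dec_; _⊎-dec_; _→-dec_; ¬?)
  open import Relation.Binary.PropositionalEquality using (_≡_; refl; sym; subst)
  open import Defs
  open Lexicographic using (module LexOrder)

  walk? : ∀ (H : Graph) u w l → Dec (Walk H u w l)
  walk? H u w [] with u ≟ w
  ... | yes refl = yes nil
  ... | no u≢w = no λ { nil → u≢w refl }
  walk? H u w (a ∷ l) with src H a ≟ u | walk? H (tgt H a) w l
  ... | yes p | yes q = yes (cons p q)
  ... | no ¬p | _ = no λ { (cons p q) → ¬p p }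
  ... | yes _ | no ¬q = no λ { (cons p q) → ¬q q }

  module Orders (H : Graph) (F : Framing H) where
    module LexIn = LexOrder (inRank F)
    module LexOut = LexOrder (outRank F)

    private
      inLtRev≡Lex : ∀ x y → inLtRev H F x y ≡ LexIn.Lex x y
      inLtRev≡Lex [] y = refl
      inLtRev≡Lex (a ∷ x) [] = refl
      inLtRev≡Lex (a ∷ x) (b ∷ y) with a ≟ b
      ... | yes _ = inLtRev≡Lex x y
      ... | no _ = refl

      outLtFwd≡Lex : ∀ x y → outLtFwd H F x y ≡ LexOut.Lex x y
      outLtFwd≡Lex [] y = refl
      outLtFwd≡Lex (a ∷ x) [] = refl
      outLtFwd≡Lex (a ∷ x) (b ∷ y) with a ≟ b
      ... | yes _ = outLtFwd≡Lex x y
      ... | no _ = refl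

    InLt≡Lex : ∀ v P Q → InLt H F v P Q ≡ LexIn.Lex (reverse (upTo H v P)) (reverse (upTo H v Q))
    InLt≡Lex v P Q = inLtRev≡Lex (reverse (upTo H v P)) (reverse (upTo H v Q))

    OutLt≡Lex : ∀ v P Q → OutLt H F v P Q ≡ LexOut.Lex (from H v P) (from H v Q)
    OutLt≡Lex v P Q = outLtFwd≡Lex (from H v P) (from H v Q)

    InLt⇒Lex : ∀ v P Q {a b} → reverse (upTo H v P) ≡ a → reverse (upTo H v Q) ≡ b →
               InLt H F v P Q → LexIn.Lex a b
    InLt⇒Lex v P Q refl refl = subst (λ T → T) (InLt≡Lex v P Q)

    Lex⇒InLt : ∀ v P Q {a b} → reverse (upTo H v P) ≡ a → reverse (upTo H v Q) ≡ b →
               LexIn.Lex a b → InLt H F v P Q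
    Lex⇒InLt v P Q refl refl = subst (λ T → T) (sym (InLt≡Lex v P Q))

    OutLt⇒Lex : ∀ v P Q {a b} → from H v P ≡ a → from H v Q ≡ b → OutLt H F v P Q → LexOut.Lex a b
    OutLt⇒Lex v P Q refl refl = subst (λ T → T) (OutLt≡Lex v P Q)

    Lex⇒OutLt : ∀ v P Q {a b} → from H v P ≡ a → from H v Q ≡ b → LexOut.Lex a b → OutLt H F v P Q
    Lex⇒OutLt v P Q refl refl = subst (λ T → T) (sym (OutLt≡Lex v P Q))

    Inverted : Fin (n H) → List (Fin (m H)) → List (Fin (m H)) → Set
    Inverted v P Q = InLt H F v P Q × OutLt H F v Q P

    Coherent-refl : ∀ {P} → Coherent H F P P
    Coherent-refl {P} v _ _ (inj₁ (lt , _)) = LexIn.Lex-irrefl (reverse (upTo H v P)) (InLt⇒Lex v P P refl refl lt)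
    Coherent-refl {P} v _ _ (inj₂ (lt , _)) = LexIn.Lex-irrefl (reverse (upTo H v P)) (InLt⇒Lex v P P refl refl lt)

    Coherent-sym : ∀ {P Q} → Coherent H F P Q → Coherent H F Q P
    Coherent-sym coh v inQ inP (inj₁ x) = coh v inP inQ (inj₂ x)
    Coherent-sym coh v inQ inP (inj₂ x) = coh v inP inQ (inj₁ x)

    InnerVertex? : ∀ R v → Dec (InnerVertex H R v)
    InnerVertex? R v = any? (λ a → tgt H a ≟ v) R ×-dec any? (λ a → src H a ≟ v) R

    InLt? : ∀ v P Q → Dec (InLt H F v P Q)
    InLt? v P Q = subst Dec (sym (InLt≡Lex v P Q)) (LexIn.Lex? (reverse (upTo H v P)) (reverse (upTo H v Q)))

    OutLt? : ∀ v P Q → Dec (OutLt H F v P Q)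
    OutLt? v P Q = subst Dec (sym (OutLt≡Lex v P Q)) (LexOut.Lex? (from H v P) (from H v Q))

    Incoherent? : ∀ v P Q → Dec (Incoherent H F v P Q)
    Incoherent? v P Q = (InLt? v P Q ×-dec OutLt? v Q P) ⊎-dec (InLt? v Q P ×-dec OutLt? v P Q)

    Coherent? : ∀ P Q → Dec (Coherent H F P Q)
    Coherent? P Q = all? (λ v → InnerVertex? P v →-dec InnerVertex? Q v →-dec ¬? (Incoherent? v P Q))

    IsClique-∷ : ∀ {A Z} → IsClique H F A → IsRoute H Z → (∀ R → R ∈ A → Coherent H F Z R) → IsClique H F (Z ∷ A)
    IsClique-∷ (routes , coherent) Z-route Z-coherent = Z-route ∷ routes , pairwise
      where
      pairwise : ∀ P Q → P ∈ _ ∷ _ → Q ∈ _ ∷ _ → Coherent H F P Q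
      pairwise P Q (here refl) (here refl) = Coherent-refl
      pairwise P Q (here refl) (there Q∈) = Z-coherent Q Q∈
      pairwise P Q (there P∈) (here refl) = Coherent-sym (Z-coherent P P∈)
      pairwise P Q (there P∈) (there Q∈) = coherent P Q P∈ Q∈

    maximal-absorbs : ∀ {A Z} → IsMaxClique H F A → IsRoute H Z → (∀ R → R ∈ A → Coherent H F Z R) → Z ∈ A
    maximal-absorbs (clique , maximal) Z-route Z-coherent = maximal _ (IsClique-∷ clique Z-route Z-coherent) there (here refl)

module Extension where

  open import Data.Nat using (ℕ; zero; suc; _+_; s≤s⁻¹) renaming (_<_ to _<ℕ_; _≤_ to _≤ℕ_)
  open import Data.Nat.Properties using (<-trans; <-irrefl; ≤-refl; ≤-trans; <-≤-trans; +-suc; +-monoˡ-≤; +-identityʳ; m≤n+m)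
    renaming (_<?_ to _<ℕ?_)
  open import Data.Fin using (Fin; _≟_; toℕ; _<_)
  open import Data.Fin.Properties using (toℕ<n)
  open import Data.List using (List; []; _∷_; _++_; reverse; filter; head)
  open import Data.List.Properties using (++-assoc; ++-identityʳ)
  open import Data.List.Membership.Propositional using (_∈_)
  open import Data.List.Membership.Propositional.Properties using (∈-filter⁺; ∈-filter⁻)
  open import Data.List.Relation.Unary.Any using (Any; here; there; any?)
  open import Data.List.Relation.Unary.Any.Properties using (++⁻)
  open import Data.List.Relation.Unary.All using (lookup)
  open import Data.Maybe using (fromMaybe)
  open import Data.Product as Prod using (Σ-syntax; _×_; _,_; proj₁; proj₂)
  open import Data.Sum as Sum using (_⊎_; inj₁; inj₂; [_,_])
  open import Data.Empty using (⊥-elim)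
  open import Function using (_∘_)
  open import Relation.Nullary using (¬_; yes; no; Dec)
  open import Relation.Binary.PropositionalEquality using (_≡_; _≢_; refl; sym; trans; cong; subst; ≢-sym)
  open import Defs
  open Walks
  open FramingOrders
  open Staircase

  module Extend (H : Graph) (F : Framing H) (increasing : ∀ a → src H a < tgt H a) where
    open Monotone H increasing
    open Orders H F

    RouteSplit : List E → Set
    RouteSplit = Split (s H) (t H)

    rankIn rankOut : E → ℕ
    rankIn = inRank F
    rankOut = outRank F

    pre-empty : ∀ {R} (σ : RouteSplit R) → src H (edge σ) ≡ s H → pre σ ≡ []
    pre-empty σ u≡s = loop-empty (subst (λ v → Walk H (s H) v (pre σ)) u≡s (pre-walk σ))

    post-empty : ∀ {R} (σ : RouteSplit R) → tgt H (edge σ) ≡ t H → post σ ≡ []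
    post-empty σ v≡t = loop-empty (subst (λ v → Walk H v (t H) (post σ)) v≡t (post-walk σ))

    distinct-entries-inverted : ∀ {w R R′} (σ : RouteSplit R) (σ′ : RouteSplit R′) →
      tgt H (edge σ) ≡ w → tgt H (edge σ′) ≡ w → rankIn (edge σ) <ℕ rankIn (edge σ′) →
      LexOut.Lex (post σ′) (post σ) → Inverted w R R′
    distinct-entries-inverted {w} {R} {R′} σ σ′ eσ eσ′ x<x′ post′<post =
      Lex⇒InLt w R R′ (reverse-upTo-entry σ eσ) (reverse-upTo-entry σ′ eσ′)
        (LexIn.Lex-head⁺ (reverse (pre σ)) (reverse (pre σ′)) (λ { refl → <-irrefl refl x<x′ }) x<x′) ,
      Lex⇒OutLt w R′ R (from-entry σ′ eσ′) (from-entry σ eσ) post′<post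

    inverted-distinct-entries : ∀ {w R R′} (σ : RouteSplit R) (σ′ : RouteSplit R′) →
      tgt H (edge σ) ≡ w → tgt H (edge σ′) ≡ w → edge σ ≢ edge σ′ → Inverted w R R′ →
      rankIn (edge σ) <ℕ rankIn (edge σ′) × LexOut.Lex (post σ′) (post σ)
    inverted-distinct-entries {w} {R} {R′} σ σ′ eσ eσ′ x≢x′ (inLt , outLt) =
      LexIn.Lex-head⁻ (reverse (pre σ)) (reverse (pre σ′)) x≢x′
        (InLt⇒Lex w R R′ (reverse-upTo-entry σ eσ) (reverse-upTo-entry σ′ eσ′) inLt) ,
      OutLt⇒Lex w R′ R (from-entry σ′ eσ′) (from-entry σ eσ) outLt

    inverted-shared-entry : ∀ {w u R R′} (σ : RouteSplit R) (σ′ : RouteSplit R′) →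
      tgt H (edge σ) ≡ w → edge σ ≡ edge σ′ → src H (edge σ) ≡ u → s H < u → Inverted w R R′ → Inverted u R R′
    inverted-shared-entry {w} {u} {R} {R′} σ σ′@(split _ _ _ _ _ _) eσ refl eu s<u (inLt , outLt) =
      Lex⇒InLt u R R′ (cong reverse (upTo-exit σ eu s<u)) (cong reverse (upTo-exit σ′ eu s<u))
        (LexIn.Lex-∷⁻ (edge σ) (reverse (pre σ)) (reverse (pre σ′))
          (InLt⇒Lex w R R′ (reverse-upTo-entry σ eσ) (reverse-upTo-entry σ′ eσ) inLt)) ,
      Lex⇒OutLt u R′ R (from-exit σ′ eu) (from-exit σ eu)
        (LexOut.Lex-∷⁺ (edge σ) (post σ′) (post σ) (OutLt⇒Lex w R′ R (from-entry σ′ eσ) (from-entry σ eσ) outLt))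

    not-inverted-at-source-entry : ∀ {w R R′} (σ : RouteSplit R) (σ′ : RouteSplit R′) →
      tgt H (edge σ) ≡ w → edge σ ≡ edge σ′ → src H (edge σ) ≡ s H → ¬ Inverted w R R′
    not-inverted-at-source-entry {w} {R} {R′} σ σ′@(split _ _ _ _ _ _) eσ refl u≡s (inLt , _) =
      LexIn.Lex-irrefl (edge σ ∷ [])
        (InLt⇒Lex w R R′ (entry-from-source σ u≡s eσ) (entry-from-source σ′ u≡s eσ) inLt)
      where
      entry-from-source : ∀ {R} (τ : RouteSplit R) → src H (edge τ) ≡ s H → tgt H (edge τ) ≡ w →
                    reverse (upTo H w R) ≡ edge τ ∷ []
      entry-from-source τ τ-src τ-tgt = trans (reverse-upTo-entry τ τ-tgt) (cong (λ l → edge τ ∷ reverse l) (pre-empty τ τ-src))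

    distinct-exits-inverted : ∀ {w R R′} (σ : RouteSplit R) (σ′ : RouteSplit R′) →
      src H (edge σ) ≡ w → src H (edge σ′) ≡ w → s H < w → rankOut (edge σ′) <ℕ rankOut (edge σ) →
      LexIn.Lex (reverse (pre σ)) (reverse (pre σ′)) → Inverted w R R′
    distinct-exits-inverted {w} {R} {R′} σ σ′ eσ eσ′ s<w x′<x pre<pre′ =
      Lex⇒InLt w R R′ (cong reverse (upTo-exit σ eσ s<w)) (cong reverse (upTo-exit σ′ eσ′ s<w)) pre<pre′ ,
      Lex⇒OutLt w R′ R (from-exit σ′ eσ′) (from-exit σ eσ)
        (LexOut.Lex-head⁺ (post σ′) (post σ) (λ { refl → <-irrefl refl x′<x }) x′<x)

    inverted-distinct-exits : ∀ {w R R′} (σ : RouteSplit R) (σ′ : RouteSplit R′) →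
      src H (edge σ) ≡ w → src H (edge σ′) ≡ w → s H < w → edge σ ≢ edge σ′ → Inverted w R R′ →
      rankOut (edge σ′) <ℕ rankOut (edge σ) × LexIn.Lex (reverse (pre σ)) (reverse (pre σ′))
    inverted-distinct-exits {w} {R} {R′} σ σ′ eσ eσ′ s<w x≢x′ (inLt , outLt) =
      LexOut.Lex-head⁻ (post σ′) (post σ) (≢-sym x≢x′) (OutLt⇒Lex w R′ R (from-exit σ′ eσ′) (from-exit σ eσ) outLt) ,
      InLt⇒Lex w R R′ (cong reverse (upTo-exit σ eσ s<w)) (cong reverse (upTo-exit σ′ eσ′ s<w)) inLt

    inverted-shared-exit : ∀ {w v R R′} (σ : RouteSplit R) (σ′ : RouteSplit R′) →
      src H (edge σ) ≡ w → edge σ ≡ edge σ′ → s H < w → tgt H (edge σ) ≡ v → Inverted w R R′ → Inverted v R R′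
    inverted-shared-exit {w} {v} {R} {R′} σ σ′@(split _ _ _ _ _ _) eσ refl s<w ev (inLt , outLt) =
      Lex⇒InLt v R R′ (reverse-upTo-entry σ ev) (reverse-upTo-entry σ′ ev)
        (LexIn.Lex-∷⁺ (edge σ) (reverse (pre σ)) (reverse (pre σ′))
          (InLt⇒Lex w R R′ (cong reverse (upTo-exit σ eσ s<w)) (cong reverse (upTo-exit σ′ eσ s<w)) inLt)) ,
      Lex⇒OutLt v R′ R (from-entry σ′ ev) (from-entry σ ev)
        (LexOut.Lex-∷⁻ (edge σ) (post σ′) (post σ) (OutLt⇒Lex w R′ R (from-exit σ′ eσ) (from-exit σ eσ) outLt))

    not-inverted-at-sink-exit : ∀ {w R R′} (σ : RouteSplit R) (σ′ : RouteSplit R′) →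
      src H (edge σ) ≡ w → edge σ ≡ edge σ′ → tgt H (edge σ) ≡ t H → ¬ Inverted w R R′
    not-inverted-at-sink-exit {w} {R} {R′} σ σ′@(split _ _ _ _ _ _) eσ refl v≡t (_ , outLt) =
      LexOut.Lex-irrefl (edge σ ∷ [])
        (OutLt⇒Lex w R′ R (exit-into-sink σ′ v≡t eσ) (exit-into-sink σ v≡t eσ) outLt)
      where
      exit-into-sink : ∀ {R} (τ : RouteSplit R) → tgt H (edge τ) ≡ t H → src H (edge τ) ≡ w →
                       from H w R ≡ edge τ ∷ []
      exit-into-sink τ τ-tgt τ-src = trans (from-exit τ τ-src) (cong (edge τ ∷_) (post-empty τ τ-tgt))

    module Backward (has-entry : ∀ w → w ≢ s H → Σ[ a ∈ E ] tgt H a ≡ w)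
                    (B : List (List E)) (B-clique : IsClique H F B) where
      open Plane _<ℕ_ LexOut.Lex

      route : ∀ {X} → X ∈ B → Walk H (s H) (t H) X
      route = lookup (proj₁ B-clique)

      entries-noncrossing : ∀ {w X X′} → w < t H → X ∈ B → X′ ∈ B → (σ : RouteSplit X) (σ′ : RouteSplit X′) →
        tgt H (edge σ) ≡ w → tgt H (edge σ′) ≡ w → ¬ Crosses (rankIn (edge σ)) (post σ) (rankIn (edge σ′)) (post σ′)
      entries-noncrossing w<t X∈B X′∈B σ σ′ eσ eσ′ crossing =
        proj₂ B-clique _ _ X∈B X′∈B _ (inner-entry σ eσ w<t) (inner-entry σ′ eσ′ w<t)
          (Sum.map (λ (x<x′ , post′<post) → distinct-entries-inverted σ σ′ eσ eσ′ x<x′ post′<post)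
                   (λ (x′<x , post<post′) → distinct-entries-inverted σ′ σ eσ′ eσ x′<x post<post′) crossing)

      -- Extending C backwards keeps every incoherence with B visible at the current start w;
      -- once w = s, which is inner to no route, none can remain.
      TracesBack : V → List E → Set
      TracesBack w C = ∀ X → X ∈ B → ∀ P → Walk H (s H) w P → ∀ u → Any (Enters u) C → InnerVertex H X u →
                       Incoherent H F u (P ++ C) X → w ≢ s H × InnerVertex H X w × Incoherent H F w (P ++ C) X

      SafeEntry : V → List E → E → Set
      SafeEntry w C b = ∀ X → X ∈ B → (σ : RouteSplit X) → tgt H (edge σ) ≡ w →
                        ¬ Crosses (rankIn b) C (rankIn (edge σ)) (post σ)

      trace-step : ∀ {w R} (ρ : RouteSplit R) → tgt H (edge ρ) ≡ w → SafeEntry w (post ρ) (edge ρ) →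
                   ∀ X → X ∈ B → InnerVertex H X w → Incoherent H F w R X →
                   src H (edge ρ) ≢ s H × InnerVertex H X (src H (edge ρ)) × Incoherent H F (src H (edge ρ)) R X
      trace-step ρ eρ safe X X∈B X-inner incoh with split-at-entry (route X∈B) (proj₁ X-inner)
      ... | σ , eσ with edge σ ≟ edge ρ
      ...   | no x≢b = ⊥-elim (safe X X∈B σ eσ (Sum.map (inverted-distinct-entries ρ σ eρ eσ (≢-sym x≢b))
                                                        (inverted-distinct-entries σ ρ eσ eρ x≢b) incoh))
      ...   | yes x≡b with src H (edge ρ) ≟ s H
      ...     | yes u≡s = ⊥-elim ([ not-inverted-at-source-entry ρ σ eρ (sym x≡b) u≡s
                                  , not-inverted-at-source-entry σ ρ eσ x≡b (trans (cong (src H) x≡b) u≡s) ] incoh)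
      ...     | no u≢s = u≢s , inner-exit σ (cong (src H) x≡b) s<u ,
                         Sum.map (inverted-shared-entry ρ σ eρ (sym x≡b) refl s<u)
                                 (inverted-shared-entry σ ρ eσ x≡b (cong (src H) x≡b) s<u) incoh
        where
        s<u : s H < src H (edge ρ)
        s<u = walk-< (pre-walk ρ) (≢-sym u≢s)

      TracesBack-∷ : ∀ {b C} → Walk H (tgt H b) (t H) C → SafeEntry (tgt H b) C b → TracesBack (tgt H b) C →
                     TracesBack (src H b) (b ∷ C)
      TracesBack-∷ wC safe traces X X∈B P wP u (here refl) X-inner incoh =
        trace-step (split P _ _ refl wP wC) refl safe X X∈B X-inner incoh
      TracesBack-∷ {b} {C} wC safe traces X X∈B P wP u (there C-enters) X-inner incoh
        with traces X X∈B (P ++ b ∷ []) (walk-++ wP (cons refl nil)) u C-enters X-inner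
               (subst (λ R → Incoherent H F u R X) (sym (++-assoc P (b ∷ []) C)) incoh)
      ... | _ , X-inner′ , incoh′ =
        trace-step (split P b C refl wP wC) refl safe X X∈B X-inner′
          (subst (λ R → Incoherent H F (tgt H b) R X) (++-assoc P (b ∷ []) C) incoh′)

      module _ {w : V} (w≢s : w ≢ s H) (w<t : w < t H) where
        private
          through-w? : ∀ X → Dec (Any (Enters w) X)
          through-w? = any? (λ a → tgt H a ≟ w)

          entry-rank : List E → ℕ
          entry-rank X = rankIn (fromMaybe (proj₁ (has-entry w w≢s)) (head (reverse (upTo H w X))))

          entry-rank-split : ∀ {X} (σ : RouteSplit X) → tgt H (edge σ) ≡ w → entry-rank X ≡ rankIn (edge σ)
          entry-rank-split σ eσ = cong (rankIn ∘ fromMaybe _ ∘ head) (reverse-upTo-entry σ eσ)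

          noncrossing : ∀ X X′ → X ∈ filter through-w? B → X′ ∈ filter through-w? B →
                        ¬ Crosses (entry-rank X) (from H w X) (entry-rank X′) (from H w X′)
          noncrossing X X′ X∈ X′∈ crossing with ∈-filter⁻ through-w? {xs = B} X∈ | ∈-filter⁻ through-w? {xs = B} X′∈
          ... | X∈B , X-w | X′∈B , X′-w with split-at-entry (route X∈B) X-w | split-at-entry (route X′∈B) X′-w
          ...   | σ , eσ | σ′ , eσ′ = entries-noncrossing w<t X∈B X′∈B σ σ′ eσ eσ′
                     (Crosses-cong (entry-rank-split σ eσ) (from-entry σ eσ)
                                   (entry-rank-split σ′ eσ′) (from-entry σ′ eσ′) crossing)

        safe-entry : ∀ {C} → Σ[ b ∈ E ] tgt H b ≡ w × SafeEntry w C b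
        safe-entry {C} with filter through-w? B in through
        ... | [] = proj₁ (has-entry w w≢s) , proj₂ (has-entry w w≢s) , none-through
          where
          none-through : ∀ {b} → SafeEntry w C b
          none-through X X∈B σ eσ _ with subst (X ∈_) through (∈-filter⁺ through-w? X∈B (enters-at-entry σ eσ))
          ... | ()
        ... | X₀ ∷ Xs with uncrossed-at entry-rank (from H w) <-trans (<-irrefl refl) _<ℕ?_
                             (λ {x} {y} {z} → LexOut.Lex-trans x y z) LexOut.Lex? X₀ Xs
                             (λ X X′ X∈ X′∈ → noncrossing X X′ (subst (X ∈_) (sym through) X∈)
                                                                (subst (X′ ∈_) (sym through) X′∈))
                             C
        ...   | a , a∈ , a-uncrossed with ∈-filter⁻ through-w? {xs = B} (subst (a ∈_) (sym through) a∈)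
        ...     | a∈B , a-w with split-at-entry (route a∈B) a-w
        ...       | σa , eσa = edge σa , eσa , safe
          where
          safe : SafeEntry w C (edge σa)
          safe X X∈B σ eσ crossing =
            a-uncrossed X (subst (X ∈_) through (∈-filter⁺ through-w? X∈B (enters-at-entry σ eσ)))
              (Crosses-cong (sym (entry-rank-split σa eσa)) refl (sym (entry-rank-split σ eσ)) (sym (from-entry σ eσ)) crossing)

      extend : ∀ k w → toℕ w <ℕ k → ∀ C → Walk H w (t H) C → w < t H → TracesBack w C →
               Σ[ P ∈ List E ] Walk H (s H) w P × (∀ X → X ∈ B → Coherent H F (P ++ C) X)
      extend (suc k) w w<k C wC w<t traces with w ≟ s H
      ... | yes refl = [] , nil , λ X X∈B v C-inner X-inner incoh →
                         proj₁ (traces X X∈B [] nil v (proj₁ C-inner) X-inner incoh) refl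
      ... | no w≢s with safe-entry w≢s w<t {C}
      ...   | b , refl , safe with extend k (src H b) (<-≤-trans (increasing b) (s≤s⁻¹ w<k)) (b ∷ C) (cons refl wC)
                                      (<-trans (increasing b) w<t) (TracesBack-∷ wC safe traces)
      ...     | P , wP , coh = P ++ b ∷ [] , walk-++ wP (cons refl nil) ,
                               λ X X∈B → subst (λ R → Coherent H F R X) (sym (++-assoc P (b ∷ []) C)) (coh X X∈B)

      backward-extension : ∀ c → tgt H c ≡ t H →
                           Σ[ P ∈ List E ] Walk H (s H) (src H c) P × (∀ X → X ∈ B → Coherent H F (P ++ c ∷ []) X)
      backward-extension c refl = extend (suc (toℕ (src H c))) (src H c) ≤-refl (c ∷ []) (cons refl nil) (increasing c) base
        where
        base : TracesBack (src H c) (c ∷ [])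
        base X X∈B P wP u (here refl) X-inner incoh = ⊥-elim (end-not-left (route X∈B) (proj₂ X-inner))

    module Forward (has-exit : ∀ w → w ≢ t H → Σ[ a ∈ E ] src H a ≡ w)
                   (B : List (List E)) (B-clique : IsClique H F B) where
      open Plane _<ℕ_ LexIn.Lex

      route : ∀ {X} → X ∈ B → Walk H (s H) (t H) X
      route = lookup (proj₁ B-clique)

      exits-noncrossing : ∀ {w X X′} → s H < w → X ∈ B → X′ ∈ B → (σ : RouteSplit X) (σ′ : RouteSplit X′) →
        src H (edge σ) ≡ w → src H (edge σ′) ≡ w →
        ¬ Crosses (rankOut (edge σ)) (reverse (pre σ)) (rankOut (edge σ′)) (reverse (pre σ′))
      exits-noncrossing s<w X∈B X′∈B σ σ′ eσ eσ′ crossing =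
        proj₂ B-clique _ _ X∈B X′∈B _ (inner-exit σ eσ s<w) (inner-exit σ′ eσ′ s<w)
          (Sum.swap (Sum.map (λ (x<x′ , pre′<pre) → distinct-exits-inverted σ′ σ eσ′ eσ s<w x<x′ pre′<pre)
                             (λ (x′<x , pre<pre′) → distinct-exits-inverted σ σ′ eσ eσ′ s<w x′<x pre<pre′) crossing))

      TracesForward : V → List E → Set
      TracesForward w C = ∀ X → X ∈ B → ∀ Q → Walk H w (t H) Q → ∀ u → Any (Leaves u) C → InnerVertex H X u →
                          Incoherent H F u (C ++ Q) X → w ≢ t H × InnerVertex H X w × Incoherent H F w (C ++ Q) X

      SafeExit : V → List E → E → Set
      SafeExit w C b = ∀ X → X ∈ B → (σ : RouteSplit X) → src H (edge σ) ≡ w →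
                       ¬ Crosses (rankOut b) (reverse C) (rankOut (edge σ)) (reverse (pre σ))

      trace-step : ∀ {w R} (ρ : RouteSplit R) → src H (edge ρ) ≡ w → s H < w → SafeExit w (pre ρ) (edge ρ) →
                   ∀ X → X ∈ B → InnerVertex H X w → Incoherent H F w R X →
                   tgt H (edge ρ) ≢ t H × InnerVertex H X (tgt H (edge ρ)) × Incoherent H F (tgt H (edge ρ)) R X
      trace-step ρ eρ s<w safe X X∈B X-inner incoh with split-at-exit (route X∈B) (proj₂ X-inner)
      ... | σ , eσ with edge σ ≟ edge ρ
      ...   | no x≢b = ⊥-elim (safe X X∈B σ eσ (Sum.swap (Sum.map (inverted-distinct-exits ρ σ eρ eσ s<w (≢-sym x≢b))
                                                                   (inverted-distinct-exits σ ρ eσ eρ s<w x≢b) incoh)))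
      ...   | yes x≡b with tgt H (edge ρ) ≟ t H
      ...     | yes v≡t = ⊥-elim ([ not-inverted-at-sink-exit ρ σ eρ (sym x≡b) v≡t
                                  , not-inverted-at-sink-exit σ ρ eσ x≡b (trans (cong (tgt H) x≡b) v≡t) ] incoh)
      ...     | no v≢t = v≢t , inner-entry σ (cong (tgt H) x≡b) v<t ,
                         Sum.map (inverted-shared-exit ρ σ eρ (sym x≡b) s<w refl)
                                 (inverted-shared-exit σ ρ eσ x≡b s<w (cong (tgt H) x≡b)) incoh
        where
        v<t : tgt H (edge ρ) < t H
        v<t = walk-< (post-walk ρ) v≢t

      TracesForward-∷ʳ : ∀ {b C} → s H < src H b → Walk H (s H) (src H b) C → SafeExit (src H b) C b →
                         TracesForward (src H b) C → TracesForward (tgt H b) (C ++ b ∷ [])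
      TracesForward-∷ʳ {b} {C} s<w wC safe traces X X∈B Q wQ u C-leaves X-inner incoh =
        Prod.map₂ (Prod.map₂ (subst (λ R → Incoherent H F (tgt H b) R X) (sym (++-assoc C (b ∷ []) Q))))
                  (reach (++⁻ C C-leaves) X-inner (subst (λ R → Incoherent H F u R X) (++-assoc C (b ∷ []) Q) incoh))
        where
        ρ : RouteSplit (C ++ b ∷ Q)
        ρ = split C b Q refl wC wQ
        reach : ∀ {u} → Any (Leaves u) C ⊎ Any (Leaves u) (b ∷ []) → InnerVertex H X u → Incoherent H F u (C ++ b ∷ Q) X →
                tgt H b ≢ t H × InnerVertex H X (tgt H b) × Incoherent H F (tgt H b) (C ++ b ∷ Q) X
        reach (inj₂ (here refl)) X-inner incoh = trace-step ρ refl s<w safe X X∈B X-inner incoh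
        reach {u} (inj₁ C-leaves) X-inner incoh with traces X X∈B (b ∷ Q) (cons refl wQ) u C-leaves X-inner incoh
        ... | _ , X-inner′ , incoh′ = trace-step ρ refl s<w safe X X∈B X-inner′ incoh′

      module _ {w : V} (w≢t : w ≢ t H) (s<w : s H < w) where
        private
          through-w? : ∀ X → Dec (Any (Leaves w) X)
          through-w? = any? (λ a → src H a ≟ w)

          exit-rank : List E → ℕ
          exit-rank X = rankOut (fromMaybe (proj₁ (has-exit w w≢t)) (head (from H w X)))

          exit-rank-split : ∀ {X} (σ : RouteSplit X) → src H (edge σ) ≡ w → exit-rank X ≡ rankOut (edge σ)
          exit-rank-split σ eσ = cong (rankOut ∘ fromMaybe _ ∘ head) (from-exit σ eσ)

          before-w : ∀ {X} (σ : RouteSplit X) → src H (edge σ) ≡ w → reverse (upTo H w X) ≡ reverse (pre σ)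
          before-w σ eσ = cong reverse (upTo-exit σ eσ s<w)

          noncrossing : ∀ X X′ → X ∈ filter through-w? B → X′ ∈ filter through-w? B →
                        ¬ Crosses (exit-rank X) (reverse (upTo H w X)) (exit-rank X′) (reverse (upTo H w X′))
          noncrossing X X′ X∈ X′∈ crossing with ∈-filter⁻ through-w? {xs = B} X∈ | ∈-filter⁻ through-w? {xs = B} X′∈
          ... | X∈B , X-w | X′∈B , X′-w with split-at-exit (route X∈B) X-w | split-at-exit (route X′∈B) X′-w
          ...   | σ , eσ | σ′ , eσ′ = exits-noncrossing s<w X∈B X′∈B σ σ′ eσ eσ′
                     (Crosses-cong (exit-rank-split σ eσ) (before-w σ eσ) (exit-rank-split σ′ eσ′) (before-w σ′ eσ′) crossing)

        safe-exit : ∀ {C} → Σ[ b ∈ E ] src H b ≡ w × SafeExit w C b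
        safe-exit {C} with filter through-w? B in through
        ... | [] = proj₁ (has-exit w w≢t) , proj₂ (has-exit w w≢t) , none-through
          where
          none-through : ∀ {b} → SafeExit w C b
          none-through X X∈B σ eσ _ with subst (X ∈_) through (∈-filter⁺ through-w? X∈B (leaves-at-exit σ eσ))
          ... | ()
        ... | X₀ ∷ Xs with uncrossed-at exit-rank (reverse ∘ upTo H w) <-trans (<-irrefl refl) _<ℕ?_
                             (λ {x} {y} {z} → LexIn.Lex-trans x y z) LexIn.Lex? X₀ Xs
                             (λ X X′ X∈ X′∈ → noncrossing X X′ (subst (X ∈_) (sym through) X∈)
                                                                (subst (X′ ∈_) (sym through) X′∈))
                             (reverse C)
        ...   | a , a∈ , a-uncrossed with ∈-filter⁻ through-w? {xs = B} (subst (a ∈_) (sym through) a∈)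
        ...     | a∈B , a-w with split-at-exit (route a∈B) a-w
        ...       | σa , eσa = edge σa , eσa , safe
          where
          safe : SafeExit w C (edge σa)
          safe X X∈B σ eσ crossing =
            a-uncrossed X (subst (X ∈_) through (∈-filter⁺ through-w? X∈B (leaves-at-exit σ eσ)))
              (Crosses-cong (sym (exit-rank-split σa eσa)) refl (sym (exit-rank-split σ eσ)) (sym (before-w σ eσ)) crossing)

      extend : ∀ k w → n H ≤ℕ toℕ w + k → s H < w → ∀ C → Walk H (s H) w C → TracesForward w C →
               Σ[ Q ∈ List E ] Walk H w (t H) Q × (∀ X → X ∈ B → Coherent H F (C ++ Q) X)
      extend k w bound s<w C wC traces with w ≟ t H
      ... | yes refl = [] , nil , λ X X∈B v C-inner X-inner incoh →
            proj₁ (traces X X∈B [] nil v (subst (Any (Leaves v)) (++-identityʳ C) (proj₂ C-inner)) X-inner incoh) refl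
      extend zero w bound s<w C wC traces | no w≢t =
        ⊥-elim (<-irrefl refl (<-≤-trans (toℕ<n w) (subst (n H ≤ℕ_) (+-identityʳ (toℕ w)) bound)))
      extend (suc k) w bound s<w C wC traces | no w≢t with safe-exit w≢t s<w {C}
      ... | b , refl , safe with extend k (tgt H b) bound′ (<-trans s<w (increasing b)) (C ++ b ∷ [])
                                    (walk-++ wC (cons refl nil)) (TracesForward-∷ʳ s<w wC safe traces)
        where
        bound′ : n H ≤ℕ toℕ (tgt H b) + k
        bound′ = ≤-trans bound (subst (_≤ℕ toℕ (tgt H b) + k) (sym (+-suc (toℕ w) k)) (+-monoˡ-≤ k (increasing b)))
      ...   | Q , wQ , coh = b ∷ Q , cons refl wQ ,
                             λ X X∈B → subst (λ R → Coherent H F R X) (++-assoc C (b ∷ []) Q) (coh X X∈B)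

      forward-extension : ∀ c → src H c ≡ s H →
                          Σ[ Q ∈ List E ] Walk H (tgt H c) (t H) Q × (∀ X → X ∈ B → Coherent H F (c ∷ Q) X)
      forward-extension c refl = extend (n H) (tgt H c) (m≤n+m (n H) (toℕ (tgt H c))) (increasing c) (c ∷ []) (cons refl nil) base
        where
        base : TracesForward (tgt H c) (c ∷ [])
        base X X∈B Q wQ u (here refl) X-inner incoh = ⊥-elim (<-irrefl refl (proj₁ (entered-inside (route X∈B) (proj₁ X-inner))))

module SplitGraph where

  open import Data.Nat using (zero; suc; _+_) renaming (_≤_ to _≤ℕ_; _<_ to _<ℕ_)
  open import Data.Nat.Properties
    using (<-trans; <-irrefl; ≤-refl; ≤-trans; <-≤-trans; +-suc; +-monoˡ-≤; +-identityʳ; m≤n+m; ≤-pred)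
  open import Data.Fin using (Fin; zero; suc; _≟_; toℕ; _<_)
  open import Data.Fin.Properties using (toℕ<n)
  open import Data.List using (List; []; _∷_; _++_; map; reverse)
  open import Data.List.Properties using (map-++; reverse-map)
  open import Data.List.Membership.Propositional using (_∈_; _∉_)
  import Data.List.Membership.DecPropositional as DecMembership
  open import Data.List.Relation.Unary.Any as Any using (Any; here; there)
  import Data.List.Relation.Unary.Any.Properties as AnyP
  open import Data.Product using (Σ-syntax; _×_; _,_; proj₁; proj₂)
  open import Data.Empty using (⊥-elim)
  open import Function using (_∘_)
  open import Relation.Nullary using (yes; no)
  open import Relation.Binary.PropositionalEquality using (_≡_; _≢_; refl; sym; trans; cong; subst)
  open import Defs
  open Walks

  module FlowGraph (G : Graph) (fg : IsFlowGraph G) where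
    open IsFlowGraph fg

    private
      source-least′ : ∀ k v → toℕ v <ℕ k → v ≢ s G → s G < v
      source-least′ (suc k) v v<k v≢s with s-unique v v≢s
      ... | a , refl with src G a ≟ s G
      ...   | yes a-from-s = subst (_< tgt G a) a-from-s (increasing a)
      ...   | no a-not-from-s =
        <-trans (source-least′ k (src G a) (<-≤-trans (increasing a) (≤-pred v<k)) a-not-from-s) (increasing a)

      sink-greatest′ : ∀ k v → n G ≤ℕ toℕ v + k → v ≢ t G → v < t G
      sink-greatest′ zero v bound _ =
        ⊥-elim (<-irrefl refl (<-≤-trans (toℕ<n v) (subst (n G ≤ℕ_) (+-identityʳ (toℕ v)) bound)))
      sink-greatest′ (suc k) v bound v≢t with t-unique v v≢t
      ... | a , refl with tgt G a ≟ t G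
      ...   | yes a-to-t = subst (src G a <_) a-to-t (increasing a)
      ...   | no a-not-to-t = <-trans (increasing a) (sink-greatest′ k (tgt G a) bound′ a-not-to-t)
        where
        bound′ : n G ≤ℕ toℕ (tgt G a) + k
        bound′ = ≤-trans bound (subst (_≤ℕ toℕ (tgt G a) + k) (sym (+-suc (toℕ (src G a)) k)) (+-monoˡ-≤ k (increasing a)))

    source-least : ∀ v → v ≢ s G → s G < v
    source-least v = source-least′ (suc (toℕ v)) v ≤-refl

    sink-greatest : ∀ v → v ≢ t G → v < t G
    sink-greatest v = sink-greatest′ (n G) v (m≤n+m (n G) (toℕ v))

  module Splitting (G : Graph) (fg : IsFlowGraph G) (e : Fin (m G)) (ie : InnerEdge G e) where
    open IsFlowGraph fg
    open FlowGraph G fg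

    Gₑ : Graph
    Gₑ = M G e

    E Eₑ V : Set
    E = Fin (m G)
    Eₑ = Fin (suc (m G))
    V = Fin (n G)

    i j : V
    i = src G e
    j = tgt G e

    s<i : s G < i
    s<i = source-least i (proj₁ ie)

    j<t : j < t G
    j<t = sink-greatest j (proj₂ (proj₂ (proj₂ ie)))

    i<t : i < t G
    i<t = <-trans (increasing e) j<t

    s<j : s G < j
    s<j = <-trans s<i (increasing e)

    s<t : s G < t G
    s<t = <-trans s<i i<t

    tgtₑ-old : ∀ k → k ≢ e → tgt Gₑ (suc k) ≡ tgt G k
    tgtₑ-old k k≢e with k ≟ e
    ... | yes k≡e = ⊥-elim (k≢e k≡e)
    ... | no _ = refl

    tgtₑ-e-t : tgt Gₑ (e-t e) ≡ t G
    tgtₑ-e-t with e ≟ e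
    ... | yes _ = refl
    ... | no e≢e = ⊥-elim (e≢e refl)

    tgtₑ-lift : ∀ {a X} → e ∉ a ∷ X → tgt Gₑ (suc a) ≡ tgt G a
    tgtₑ-lift e∉aX = tgtₑ-old _ (λ a≡e → e∉aX (here (sym a≡e)))

    increasingₑ : ∀ a → src Gₑ a < tgt Gₑ a
    increasingₑ zero = s<j
    increasingₑ (suc k) with k ≟ e
    ... | yes refl = i<t
    ... | no _ = increasing k

    has-entryₑ : ∀ w → w ≢ s G → Σ[ a ∈ Eₑ ] tgt Gₑ a ≡ w
    has-entryₑ w w≢s with s-unique w w≢s
    ... | a , a-enters with a ≟ e
    ...   | yes refl = e-s , a-enters
    ...   | no a≢e = suc a , trans (tgtₑ-old a a≢e) a-enters

    has-exitₑ : ∀ w → w ≢ t G → Σ[ a ∈ Eₑ ] src Gₑ a ≡ w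
    has-exitₑ w w≢t with t-unique w w≢t
    ... | a , a-leaves = suc a , a-leaves

    module WG = Monotone G increasing
    module WM = Monotone Gₑ increasingₑ

    original : Eₑ → E
    original = orig G e

    original-suc : ∀ l → map original (map suc l) ≡ l
    original-suc [] = refl
    original-suc (a ∷ l) = cong (a ∷_) (original-suc l)

    lift-walk : ∀ {u w l} → Walk G u w l → e ∉ l → Walk Gₑ u w (map suc l)
    lift-walk nil _ = nil
    lift-walk (cons {a = a} a-src wk) e∉ =
      cons a-src (subst (λ v → Walk Gₑ v _ _) (sym (tgtₑ-lift e∉)) (lift-walk wk (e∉ ∘ there)))

    lower-walk : ∀ {u w Y} → Walk Gₑ u w Y → e-s ∉ Y → e-t e ∉ Y →
                 Σ[ l ∈ List E ] Y ≡ map suc l × e ∉ l × Walk G u w l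
    lower-walk nil _ _ = [] , refl , (λ ()) , nil
    lower-walk (cons {a = zero} _ _) e-s∉ _ = ⊥-elim (e-s∉ (here refl))
    lower-walk (cons {a = suc k} k-src wk) e-s∉ e-t∉ with lower-walk wk (λ p → e-s∉ (there p)) (λ p → e-t∉ (there p))
    ... | l , refl , e∉l , wl = k ∷ l , refl , e∉kl , cons k-src (subst (λ v → Walk G v _ l) (tgtₑ-old k k≢e) wl)
      where
      k≢e : k ≢ e
      k≢e k≡e = e-t∉ (here (cong suc (sym k≡e)))
      e∉kl : e ∉ k ∷ l
      e∉kl (here e≡k) = k≢e (sym e≡k)
      e∉kl (there p) = e∉l p

    e-s∉ : ∀ {u w Y} → Walk Gₑ u w Y → s G < u → e-s ∉ Y
    e-s∉ wk s<u e-s∈ = <-irrefl refl (<-≤-trans s<u (proj₁ (WM.left-inside wk (Any.map (λ { refl → refl }) e-s∈))))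

    e-t∉-before-t : ∀ {u w Y} → Walk Gₑ u w Y → w < t G → e-t e ∉ Y
    e-t∉-before-t wk w<t e-t∈ =
      <-irrefl refl (<-≤-trans w<t (proj₂ (WM.entered-inside wk (Any.map (λ { refl → tgtₑ-e-t }) e-t∈))))

    e-t∉-after-i : ∀ {u w Y} → Walk Gₑ u w Y → i < u → e-t e ∉ Y
    e-t∉-after-i wk i<u e-t∈ = <-irrefl refl (<-≤-trans i<u (proj₁ (WM.left-inside wk (Any.map (λ { refl → refl }) e-t∈))))

    e∉-after-j : ∀ {Q} → Walk G j (t G) Q → e ∉ Q
    e∉-after-j wk e∈ = <-irrefl refl (<-≤-trans (increasing e) (proj₁ (WG.left-inside wk (Any.map (λ { refl → refl }) e∈))))

    e∉-before-i : ∀ {P} → Walk G (s G) i P → e ∉ P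
    e∉-before-i wk e∈ = <-irrefl refl (<-≤-trans (increasing e) (proj₂ (WG.entered-inside wk (Any.map (λ { refl → refl }) e∈))))

    upTo-lift : ∀ v X → e ∉ X → upTo Gₑ v (map suc X) ≡ map suc (upTo G v X)
    upTo-lift v [] _ = refl
    upTo-lift v (a ∷ X) e∉aX with tgt G a ≟ v
    ... | yes a-enters = WM.upTo-∷-hit v (suc a) (map suc X) (trans (tgtₑ-lift e∉aX) a-enters)
    ... | no a-misses = trans (WM.upTo-∷-miss v (suc a) (map suc X) (a-misses ∘ trans (sym (tgtₑ-lift e∉aX))))
                              (cong (suc a ∷_) (upTo-lift v X (e∉aX ∘ there)))

    from-lift : ∀ v X → from Gₑ v (map suc X) ≡ map suc (from G v X)
    from-lift v [] = refl
    from-lift v (a ∷ X) with src G a ≟ v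
    ... | yes _ = refl
    ... | no _ = from-lift v X

    enters-lift : ∀ {v X} → e ∉ X → Any (WG.Enters v) X → Any (WM.Enters v) (map suc X)
    enters-lift e∉aX (here a-enters) = here (trans (tgtₑ-lift e∉aX) a-enters)
    enters-lift e∉aX (there p) = there (enters-lift (e∉aX ∘ there) p)

    enters-lower : ∀ {v X} → e ∉ X → Any (WM.Enters v) (map suc X) → Any (WG.Enters v) X
    enters-lower {X = _ ∷ _} e∉aX (here a-enters) = here (trans (sym (tgtₑ-lift e∉aX)) a-enters)
    enters-lower {X = _ ∷ _} e∉aX (there p) = there (enters-lower (e∉aX ∘ there) p)

    leaves-lift : ∀ {v X} → Any (WG.Leaves v) X → Any (WM.Leaves v) (map suc X)
    leaves-lift = AnyP.map⁺

    leaves-lower : ∀ {v X} → Any (WM.Leaves v) (map suc X) → Any (WG.Leaves v) X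
    leaves-lower = AnyP.map⁻

    original-reverse-lift : ∀ l → map original (reverse (map suc l)) ≡ reverse l
    original-reverse-lift l = trans (cong (map original) (sym (reverse-map suc l))) (original-suc (reverse l))

    original-injective-without-e-t : ∀ {a b} → e-t e ≢ a → e-t e ≢ b → original a ≡ original b → a ≡ b
    original-injective-without-e-t {zero} {zero} _ _ _ = refl
    original-injective-without-e-t {zero} {suc b} _ b≢e-t eq = ⊥-elim (b≢e-t (cong suc eq))
    original-injective-without-e-t {suc a} {zero} a≢e-t _ eq = ⊥-elim (a≢e-t (cong suc (sym eq)))
    original-injective-without-e-t {suc a} {suc b} _ _ eq = cong suc eq

    original-injective-without-e-s : ∀ {a b} → e-s ≢ a → e-s ≢ b → original a ≡ original b → a ≡ b
    original-injective-without-e-s {zero} a≢e-s _ _ = ⊥-elim (a≢e-s refl)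
    original-injective-without-e-s {suc a} {zero} _ b≢e-s _ = ⊥-elim (b≢e-s refl)
    original-injective-without-e-s {suc a} {suc b} _ _ eq = cong suc eq

    piece-s : List E → List Eₑ
    piece-s Q = e-s ∷ map suc Q

    piece-t : List E → List Eₑ
    piece-t P = map suc P ++ e-t e ∷ []

    piece-s-walk : ∀ {Q} → Walk G j (t G) Q → Walk Gₑ (s G) (t G) (piece-s Q)
    piece-s-walk wQ = cons refl (lift-walk wQ (e∉-after-j wQ))

    piece-t-walk : ∀ {P} → Walk G (s G) i P → Walk Gₑ (s G) (t G) (piece-t P)
    piece-t-walk wP = WM.walk-++ (lift-walk wP (e∉-before-i wP)) (cons refl (subst (λ v → Walk Gₑ v (t G) []) (sym tgtₑ-e-t) nil))

    inner-below-t : ∀ {p v} → Walk Gₑ (s G) (t G) p → InnerVertex Gₑ p v → v < t G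
    inner-below-t wp inn = proj₂ (WM.left-inside wp (proj₂ inn))

    inner-above-s : ∀ {p v} → Walk Gₑ (s G) (t G) p → InnerVertex Gₑ p v → s G < v
    inner-above-s wp inn = proj₁ (WM.entered-inside wp (proj₁ inn))

    upTo-piece-s : ∀ v Q → e ∉ Q → map original (upTo Gₑ v (piece-s Q)) ≡ upTo G v (e ∷ Q)
    upTo-piece-s v Q e∉Q with tgt G e ≟ v
    ... | yes _ = refl
    ... | no _ = cong (e ∷_) (trans (cong (map original) (upTo-lift v Q e∉Q)) (original-suc (upTo G v Q)))

    piece-t≡ : ∀ P → piece-t P ≡ map suc (P ++ e ∷ [])
    piece-t≡ P = sym (map-++ suc P (e ∷ []))

    data RouteView : List Eₑ → Set where
      unsplit : ∀ X → Walk G (s G) (t G) X → e ∉ X → RouteView (map suc X)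
      via-s   : ∀ Q → Walk G j (t G) Q → RouteView (piece-s Q)
      via-t   : ∀ P → Walk G (s G) i P → RouteView (piece-t P)

    e-s∉-before-j : ∀ {u w Y} → Walk Gₑ u w Y → w < j → e-s ∉ Y
    e-s∉-before-j wk w<j e-s∈ = <-irrefl refl (<-≤-trans w<j (proj₂ (WM.entered-inside wk (Any.map (λ { refl → refl }) e-s∈))))

    route-view : ∀ {Y} → Walk Gₑ (s G) (t G) Y → RouteView Y
    route-view {[]} wk = ⊥-elim (WM.lt-ne s<t (WM.walk-[] wk))
    route-view (cons {a = zero} refl wk) with lower-walk wk (e-s∉ wk s<j) (e-t∉-after-i wk (increasing e))
    ... | Q , refl , _ , wQ = via-s Q wQ
    route-view {Y} wY@(cons {a = suc k} refl wk) with DecMembership._∈?_ _≟_ (e-t e) Y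
    ... | no e-t∉ with lower-walk wY e-s∉Y e-t∉
      where
      e-s∉Y : e-s ∉ Y
      e-s∉Y (there p) = e-s∉ wk (increasingₑ (suc k)) p
    ...   | X , Y≡ , e∉X , wX = subst RouteView (sym Y≡) (unsplit X wX e∉X)
    route-view {Y} wY | yes e-t∈ with WM.split-at wY e-t∈
    ... | WM.split pre x post Y≡ wpre wpost , refl
          with WM.loop-empty (subst (λ v → Walk Gₑ v (t G) post) tgtₑ-e-t wpost)
    ...   | refl with lower-walk wpre (e-s∉-before-j wpre (increasing e)) (e-t∉-before-t wpre i<t)
    ...     | P , refl , _ , wP = subst RouteView (sym Y≡) (via-t P wP)

module SplitCoherence where

  open import Data.Nat.Properties using (<-trans; <-irrefl; <⇒≤; <-≤-trans; ≤-<-trans; ≤∧≢⇒<)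
  open import Data.Fin using (Fin; _≟_; _<_; _≤_; suc)
  open import Data.Fin.Properties using (toℕ-injective)
  open import Data.List using (List; []; _∷_; _++_; map; reverse)
  open import Data.List.Properties using (++-assoc; reverse-++; reverse-map; unfold-reverse; ++-identityʳ; reverse-injective)
  open import Data.List.Membership.Propositional using (_∈_; _∉_)
  open import Data.List.Relation.Unary.Any using (Any; here; there)
  open import Data.List.Relation.Unary.Any.Properties using (++⁺ˡ; ++⁺ʳ; ++⁻)
  open import Data.List.Relation.Unary.All using (All; []; _∷_)
  open import Data.List.Relation.Unary.All.Properties using (¬Any⇒All¬)
  import Data.List.Relation.Unary.Any.Properties as AnyP
  open import Data.Product using (Σ-syntax; _×_; _,_; proj₁; proj₂)
  open import Data.Sum as Sum using (_⊎_; inj₁; inj₂)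
  open import Data.Empty using (⊥-elim)
  open import Relation.Nullary using (¬_; yes; no)
  open import Relation.Binary.PropositionalEquality using (_≡_; _≢_; refl; sym; trans; cong; cong₂; subst; subst₂)
  open import Function using (_∘_)
  open import Function.Bundles using (_⇔_; Equivalence)
  open import Defs
  import Data.List.Membership.DecPropositional as DecMembership
  open Lexicographic
  open Walks
  open FramingOrders
  open SplitGraph

  module PieceCoherence (G : Graph) (fg : IsFlowGraph G) (F : Framing G) (e : Fin (m G)) (ie : InnerEdge G e)
                        (F′ : Framing (M G e)) (inh : Inherits G F e F′) where
    open Splitting G fg e ie
    open Inherits inh
    open IsFlowGraph fg using (increasing)
    module OG = Orders G F
    module OM = Orders Gₑ F′

    φ-through : ∀ R → e ∈ R → φ G e R ≡ piece-s (from G j R) ∷ piece-t (upTo G i R) ∷ []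
    φ-through R e∈R with DecMembership._∈?_ _≟_ e R
    ... | yes _ = refl
    ... | no e∉R = ⊥-elim (e∉R e∈R)

    φ-avoiding : ∀ R → e ∉ R → φ G e R ≡ map suc R ∷ []
    φ-avoiding R e∉R with DecMembership._∈?_ _≟_ e R
    ... | yes e∈R = ⊥-elim (e∉R e∈R)
    ... | no _ = refl

    data RouteShape : List E → Set where
      avoiding : ∀ X → Walk G (s G) (t G) X → e ∉ X → RouteShape X
      through  : ∀ P Q → Walk G (s G) i P → Walk G j (t G) Q → RouteShape (P ++ e ∷ Q)

    route-shape : ∀ {R} → Walk G (s G) (t G) R → RouteShape R
    route-shape {R} wR with DecMembership._∈?_ _≟_ e R
    ... | no e∉R = avoiding R wR e∉R
    ... | yes e∈R with WG.split-at wR e∈R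
    ...   | WG.split P x Q R≡ wP wQ , refl = subst RouteShape (sym R≡) (through P Q wP wQ)

    φ-through-split : ∀ {P Q} → Walk G (s G) i P → Walk G j (t G) Q → φ G e (P ++ e ∷ Q) ≡ piece-s Q ∷ piece-t P ∷ []
    φ-through-split {P} {Q} wP wQ =
      trans (φ-through (P ++ e ∷ Q) (++⁺ʳ P (here refl)))
            (cong₂ (λ Q′ P′ → piece-s Q′ ∷ piece-t P′ ∷ []) (WG.from-entry σ refl) (WG.upTo-exit σ refl s<i))
      where
      σ : WG.Split (s G) (t G) (P ++ e ∷ Q)
      σ = WG.split P e Q refl wP wQ

    piece-s∈φ : ∀ {P Q} → Walk G (s G) i P → Walk G j (t G) Q → piece-s Q ∈ φ G e (P ++ e ∷ Q)
    piece-s∈φ wP wQ = subst (_ ∈_) (sym (φ-through-split wP wQ)) (here refl)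

    piece-t∈φ : ∀ {P Q} → Walk G (s G) i P → Walk G j (t G) Q → piece-t P ∈ φ G e (P ++ e ∷ Q)
    piece-t∈φ wP wQ = subst (_ ∈_) (sym (φ-through-split wP wQ)) (there (here refl))

    lift∈φ : ∀ {X} → e ∉ X → map suc X ∈ φ G e X
    lift∈φ {X} e∉X = subst (map suc X ∈_) (sym (φ-avoiding X e∉X)) (here refl)

    module TI = LexMap (inRank F′) (inRank F) original
    module TO = LexMap (outRank F′) (outRank F) original

    -- Away from e-t (resp. e-s) the framing F′ ranks edges as F does, so comparisons transfer along original.
    prefix-order-original : ∀ {v P P′} → Walk Gₑ (s G) v P → Walk Gₑ (s G) v P′ → v < t G →
      OM.LexIn.Lex (reverse P) (reverse P′) ⇔ OG.LexIn.Lex (map original (reverse P)) (map original (reverse P′))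
    prefix-order-original {v} {P} {P′} wP wP′ v<t =
      TI.Lex-map (reverse P) (reverse P′)
        (Aligned-map faithful (Aligned-All (avoids wP) (avoids wP′)
                                           (WM.reverse-walks-aligned (WM.reverse-walk wP) (WM.reverse-walk wP′))))
      where
      avoids : ∀ {P} → Walk Gₑ (s G) v P → All (e-t e ≢_) (reverse P)
      avoids {P} wP = ¬Any⇒All¬ (reverse P) (e-t∉-before-t wP v<t ∘ AnyP.reverse⁻)
      faithful : ∀ {a b} → tgt Gₑ a ≡ tgt Gₑ b × e-t e ≢ a × e-t e ≢ b → TI.Faithful a b
      faithful (same-tgt , a≢e-t , b≢e-t) =
        original-injective-without-e-t a≢e-t b≢e-t , in-inherit _ _ same-tgt (a≢e-t ∘ sym) (b≢e-t ∘ sym)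

    suffix-order-original : ∀ {v Q Q′} → Walk Gₑ v (t G) Q → Walk Gₑ v (t G) Q′ → s G < v →
      OM.LexOut.Lex Q Q′ ⇔ OG.LexOut.Lex (map original Q) (map original Q′)
    suffix-order-original {v} {Q} {Q′} wQ wQ′ s<v =
      TO.Lex-map Q Q′ (Aligned-map faithful (Aligned-All (avoids wQ) (avoids wQ′) (WM.walks-aligned wQ wQ′)))
      where
      avoids : ∀ {Q} → Walk Gₑ v (t G) Q → All (e-s ≢_) Q
      avoids {Q} wQ = ¬Any⇒All¬ Q (e-s∉ wQ s<v)
      faithful : ∀ {a b} → src Gₑ a ≡ src Gₑ b × e-s ≢ a × e-s ≢ b → TO.Faithful a b
      faithful (same-src , a≢e-s , b≢e-s) =
        original-injective-without-e-s a≢e-s b≢e-s , out-inherit _ _ same-src (a≢e-s ∘ sym) (b≢e-s ∘ sym)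

    InLtₑ⇔ : ∀ {p p′ v} → Walk Gₑ (s G) (t G) p → Walk Gₑ (s G) (t G) p′ →
             InnerVertex Gₑ p v → InnerVertex Gₑ p′ v →
             InLt Gₑ F′ v p p′ ⇔ OG.LexIn.Lex (map original (reverse (upTo Gₑ v p))) (map original (reverse (upTo Gₑ v p′)))
    InLtₑ⇔ {p} {p′} {v} wp wp′ v-p v-p′ =
      subst (_⇔ OG.LexIn.Lex (map original (reverse (upTo Gₑ v p))) (map original (reverse (upTo Gₑ v p′))))
            (sym (OM.InLt≡Lex v p p′))
        (prefix-order-original (WM.upTo-walk wp (proj₁ v-p)) (WM.upTo-walk wp′ (proj₁ v-p′)) (inner-below-t wp v-p))

    OutLtₑ⇔ : ∀ {p p′ v} → Walk Gₑ (s G) (t G) p → Walk Gₑ (s G) (t G) p′ →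
              InnerVertex Gₑ p v → InnerVertex Gₑ p′ v →
              OutLt Gₑ F′ v p p′ ⇔ OG.LexOut.Lex (map original (from Gₑ v p)) (map original (from Gₑ v p′))
    OutLtₑ⇔ {p} {p′} {v} wp wp′ v-p v-p′ =
      subst (_⇔ OG.LexOut.Lex (map original (from Gₑ v p)) (map original (from Gₑ v p′))) (sym (OM.OutLt≡Lex v p p′))
        (suffix-order-original (WM.from-walk wp (proj₁ v-p)) (WM.from-walk wp′ (proj₁ v-p′)) (inner-above-s wp v-p))

    module LiftedPiece {v X} (e∉X : e ∉ X) (v-X′ : InnerVertex Gₑ (map suc X) v) where

      inner : InnerVertex G X v
      inner = enters-lower e∉X (proj₁ v-X′) , leaves-lower (proj₂ v-X′)

      up≡ : reverse (upTo G v X) ≡ map original (reverse (upTo Gₑ v (map suc X)))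
      up≡ = sym (trans (cong (λ l → map original (reverse l)) (upTo-lift v X e∉X)) (original-reverse-lift (upTo G v X)))

      from≡ : from G v X ≡ map original (from Gₑ v (map suc X))
      from≡ = sym (trans (cong (map original) (from-lift v X)) (original-suc (from G v X)))

    module SPiece {v P Q} (wP : Walk G (s G) i P) (wQ : Walk G j (t G) Q) (v-S : InnerVertex Gₑ (piece-s Q) v) where

      private
        e∉Q : e ∉ Q
        e∉Q = e∉-after-j wQ

        enters-e∷Q : Any (WM.Enters v) (piece-s Q) → Any (WG.Enters v) (e ∷ Q)
        enters-e∷Q (here e-enters) = here e-enters
        enters-e∷Q (there v∈Q) = there (enters-lower e∉Q v∈Q)

      v∈e∷Q : Any (WG.Enters v) (e ∷ Q)
      v∈e∷Q = enters-e∷Q (proj₁ v-S)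

      private
        i<v : i < v
        i<v = proj₁ (WG.entered-inside (cons refl wQ) v∈e∷Q)

        leaves-Q : Any (WM.Leaves v) (piece-s Q) → Any (WG.Leaves v) Q
        leaves-Q (here s≡v) = ⊥-elim (WG.lt-ne (<-trans s<i i<v) s≡v)
        leaves-Q (there v∈Q) = leaves-lower v∈Q

      inner : InnerVertex G (P ++ e ∷ Q) v
      inner = ++⁺ʳ P v∈e∷Q , ++⁺ʳ P (there (leaves-Q (proj₂ v-S)))

      up≡ : reverse (upTo G v (P ++ e ∷ Q)) ≡ map original (reverse (upTo Gₑ v (piece-s Q))) ++ reverse P
      up≡ = trans (cong reverse (WG.upTo-++-miss v P (e ∷ Q) (WG.not-entered-beyond wP i<v)))
                  (trans (reverse-++ P (upTo G v (e ∷ Q)))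
                         (cong (_++ reverse P) (sym (trans (reverse-map original (upTo Gₑ v (piece-s Q)))
                                                           (cong reverse (upTo-piece-s v Q e∉Q))))))

      from≡ : from G v (P ++ e ∷ Q) ≡ map original (from Gₑ v (piece-s Q))
      from≡ = trans (WG.from-++-miss v P (e ∷ Q) (WG.not-left-beyond wP (<⇒≤ i<v)))
                    (trans (WG.from-∷-miss v e Q (WG.lt-ne i<v))
                           (sym (trans (cong (map original) (trans (WM.from-∷-miss v e-s (map suc Q) (WG.lt-ne (<-trans s<i i<v)))
                                                                   (from-lift v Q)))
                                       (original-suc (from G v Q)))))

    module TPiece {v P Q} (wP : Walk G (s G) i P) (wQ : Walk G j (t G) Q) (v-T : InnerVertex Gₑ (piece-t P) v) where

      private
        e∉P : e ∉ P
        e∉P = e∉-before-i wP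

        v<t : v < t G
        v<t = inner-below-t (piece-t-walk wP) v-T

        enters-P : Any (WM.Enters v) (map suc P) ⊎ Any (WM.Enters v) (e-t e ∷ []) → Any (WM.Enters v) (map suc P)
        enters-P (inj₁ v∈P) = v∈P
        enters-P (inj₂ (here t≡v)) = ⊥-elim (WG.lt-ne v<t (trans (sym t≡v) tgtₑ-e-t))

        v∈Pₑ : Any (WM.Enters v) (map suc P)
        v∈Pₑ = enters-P (++⁻ (map suc P) (proj₁ v-T))

      v∈P : Any (WG.Enters v) P
      v∈P = enters-lower e∉P v∈Pₑ

      private
        v-leaves-Pe : Any (WG.Leaves v) (P ++ e ∷ [])
        v-leaves-Pe = leaves-lower (subst (Any (WM.Leaves v)) (piece-t≡ P) (proj₂ v-T))

      inner : InnerVertex G (P ++ e ∷ Q) v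
      inner = ++⁺ˡ v∈P , subst (Any (WG.Leaves v)) (++-assoc P (e ∷ []) Q) (AnyP.++⁺ˡ v-leaves-Pe)

      up≡ : reverse (upTo G v (P ++ e ∷ Q)) ≡ map original (reverse (upTo Gₑ v (piece-t P)))
      up≡ = trans (cong reverse (WG.upTo-++-hit v P (e ∷ Q) v∈P))
                  (sym (trans (cong (λ l → map original (reverse l))
                                    (trans (WM.upTo-++-hit v (map suc P) (e-t e ∷ []) v∈Pₑ) (upTo-lift v P e∉P)))
                              (original-reverse-lift (upTo G v P))))

      from≡ : from G v (P ++ e ∷ Q) ≡ map original (from Gₑ v (piece-t P)) ++ Q
      from≡ = trans (cong (from G v) (sym (++-assoc P (e ∷ []) Q)))
                    (trans (WG.from-++-hit v (P ++ e ∷ []) Q v-leaves-Pe)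
                           (cong (_++ Q) (sym (trans (cong (λ l → map original (from Gₑ v l)) (piece-t≡ P))
                                                     (trans (cong (map original) (from-lift v (P ++ e ∷ []))) (original-suc _))))))

    PieceExtends : List E → List Eₑ → V → Set
    PieceExtends R p v = InnerVertex G R v ×
                         (Σ[ before ∈ List E ] reverse (upTo G v R) ≡ map original (reverse (upTo Gₑ v p)) ++ before) ×
                         (Σ[ after ∈ List E ] from G v R ≡ map original (from Gₑ v p) ++ after)

    piece-extends : ∀ {R p v} → Walk G (s G) (t G) R → p ∈ φ G e R → InnerVertex Gₑ p v → PieceExtends R p v
    piece-extends {R} {p} {v} wR p∈ v-p = go (route-shape wR) p∈
      where
      go : ∀ {R} → RouteShape R → p ∈ φ G e R → PieceExtends R p v
      go (avoiding X wX e∉X) p∈ with subst (p ∈_) (φ-avoiding X e∉X) p∈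
      ... | here refl = L.inner , ([] , trans L.up≡ (sym (++-identityʳ _))) , ([] , trans L.from≡ (sym (++-identityʳ _)))
        where module L = LiftedPiece e∉X v-p
      go (through P Q wP wQ) p∈ with subst (p ∈_) (φ-through-split wP wQ) p∈
      ... | here refl = S.inner , (reverse P , S.up≡) , ([] , trans S.from≡ (sym (++-identityʳ _)))
        where module S = SPiece wP wQ v-p
      go (through P Q wP wQ) p∈ | there (here refl) = T.inner , ([] , trans T.up≡ (sym (++-identityʳ _))) , (Q , T.from≡)
        where module T = TPiece wP wQ v-p

    piece-walk : ∀ {R p} → Walk G (s G) (t G) R → p ∈ φ G e R → Walk Gₑ (s G) (t G) p
    piece-walk {R} {p} wR p∈ = go (route-shape wR) p∈
      where
      go : ∀ {R} → RouteShape R → p ∈ φ G e R → Walk Gₑ (s G) (t G) p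
      go (avoiding X wX e∉X) p∈ with subst (p ∈_) (φ-avoiding X e∉X) p∈
      ... | here refl = lift-walk wX e∉X
      go (through P Q wP wQ) p∈ with subst (p ∈_) (φ-through-split wP wQ) p∈
      ... | here refl = piece-s-walk wQ
      ... | there (here refl) = piece-t-walk wP

    inverted-pieces : ∀ {R R′ p p′ v} → Walk G (s G) (t G) R → Walk G (s G) (t G) R′ →
                      p ∈ φ G e R → p′ ∈ φ G e R′ →
                      InnerVertex Gₑ p v → InnerVertex Gₑ p′ v → OM.Inverted v p p′ → OG.Inverted v R R′
    inverted-pieces {R} {R′} {p} {p′} {v} wR wR′ p∈ p′∈ v-p v-p′ (inLt , outLt)
      with piece-extends wR p∈ v-p | piece-extends wR′ p′∈ v-p′
    ... | _ , (tin , up≡) , (tout , from≡) | _ , (tin′ , up≡′) , (tout′ , from≡′) =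
      OG.Lex⇒InLt v R R′ up≡ up≡′
        (OG.LexIn.Lex-++ (map original (reverse (upTo Gₑ v p))) (map original (reverse (upTo Gₑ v p′))) tin tin′
          (Equivalence.to (InLtₑ⇔ wp wp′ v-p v-p′) inLt)) ,
      OG.Lex⇒OutLt v R′ R from≡′ from≡
        (OG.LexOut.Lex-++ (map original (from Gₑ v p′)) (map original (from Gₑ v p)) tout′ tout
          (Equivalence.to (OutLtₑ⇔ wp′ wp v-p′ v-p) outLt))
      where
      wp : Walk Gₑ (s G) (t G) p
      wp = piece-walk wR p∈
      wp′ : Walk Gₑ (s G) (t G) p′
      wp′ = piece-walk wR′ p′∈

    φ-coherent : ∀ {R R′ p p′} → Walk G (s G) (t G) R → Walk G (s G) (t G) R′ → Coherent G F R R′ →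
                 p ∈ φ G e R → p′ ∈ φ G e R′ → Coherent Gₑ F′ p p′
    φ-coherent wR wR′ coh p∈ p′∈ v v-p v-p′ incoh =
      coh v (proj₁ (piece-extends wR p∈ v-p)) (proj₁ (piece-extends wR′ p′∈ v-p′))
        (Sum.map (inverted-pieces wR wR′ p∈ p′∈ v-p v-p′) (inverted-pieces wR′ wR p′∈ p∈ v-p′ v-p) incoh)

    Lex⇒InLtₑ : ∀ {v p p′ a b} → Walk Gₑ (s G) (t G) p → Walk Gₑ (s G) (t G) p′ →
                InnerVertex Gₑ p v → InnerVertex Gₑ p′ v →
                map original (reverse (upTo Gₑ v p)) ≡ a → map original (reverse (upTo Gₑ v p′)) ≡ b →
                OG.LexIn.Lex a b → InLt Gₑ F′ v p p′
    Lex⇒InLtₑ wp wp′ v-p v-p′ refl refl = Equivalence.from (InLtₑ⇔ wp wp′ v-p v-p′)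

    Lex⇒OutLtₑ : ∀ {v p p′ a b} → Walk Gₑ (s G) (t G) p → Walk Gₑ (s G) (t G) p′ →
                 InnerVertex Gₑ p v → InnerVertex Gₑ p′ v →
                 map original (from Gₑ v p) ≡ a → map original (from Gₑ v p′) ≡ b →
                 OG.LexOut.Lex a b → OutLt Gₑ F′ v p p′
    Lex⇒OutLtₑ wp wp′ v-p v-p′ refl refl = Equivalence.from (OutLtₑ⇔ wp wp′ v-p v-p′)

    upTo-e∷ : ∀ v Q → e ∉ Q → Σ[ U ∈ List E ] upTo G v (e ∷ Q) ≡ e ∷ U × e ∉ U
    upTo-e∷ v Q e∉Q with tgt G e ≟ v
    ... | yes _ = [] , refl , λ ()
    ... | no _ = upTo G v Q , refl , e∉Q ∘ Any-upTo⁻ v Q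

    reverse-upTo-e∷ : ∀ v Q → e ∉ Q →
                      Σ[ u ∈ List E ] reverse (upTo G v (e ∷ Q)) ≡ u ++ e ∷ [] × e ∉ u ×
                                      map original (reverse (upTo Gₑ v (piece-s Q))) ≡ reverse (upTo G v (e ∷ Q))
    reverse-upTo-e∷ v Q e∉Q with upTo-e∷ v Q e∉Q
    ... | U , up≡ , e∉U =
      reverse U , trans (cong reverse up≡) (unfold-reverse e U) , e∉U ∘ AnyP.reverse⁻ ,
      trans (reverse-map original (upTo Gₑ v (piece-s Q))) (cong reverse (upTo-piece-s v Q e∉Q))

    module _ {v : V} {Q : List E} (wQ : Walk G j (t G) Q) where

      before-e : List E
      before-e = proj₁ (reverse-upTo-e∷ v Q (e∉-after-j wQ))

      reverse-upTo-e∷≡ : reverse (upTo G v (e ∷ Q)) ≡ before-e ++ e ∷ []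
      reverse-upTo-e∷≡ = proj₁ (proj₂ (reverse-upTo-e∷ v Q (e∉-after-j wQ)))

      e∉before-e : e ∉ before-e
      e∉before-e = proj₁ (proj₂ (proj₂ (reverse-upTo-e∷ v Q (e∉-after-j wQ))))

      piece-s-before-e : map original (reverse (upTo Gₑ v (piece-s Q))) ≡ before-e ++ e ∷ []
      piece-s-before-e = trans (proj₂ (proj₂ (proj₂ (reverse-upTo-e∷ v Q (e∉-after-j wQ))))) reverse-upTo-e∷≡

    from-piece-t : ∀ {v P} → Walk G (s G) i P → Any (WG.Enters v) P →
                   map original (from Gₑ v (piece-t P)) ≡ from G v P ++ e ∷ [] × e ∉ from G v P
    from-piece-t {v} {P} wP v∈P =
      trans (cong (λ l → map original (from Gₑ v l)) (piece-t≡ P))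
            (trans (cong (map original) (from-lift v (P ++ e ∷ []))) (trans (original-suc _) from≡)) ,
      e∉-before-i wP ∘ Any-from⁻ v P
      where
      from≡ : from G v (P ++ e ∷ []) ≡ from G v P ++ e ∷ []
      from≡ with v ≟ i
      ... | yes refl = trans (WG.from-++-miss i P (e ∷ []) (WG.end-not-left wP))
                         (trans (WG.from-own-start (cons refl nil)) (cong (_++ e ∷ []) (sym from-i-empty)))
        where
        from-i-empty : from G i P ≡ []
        from-i-empty = WG.loop-empty (WG.from-walk wP v∈P)
      ... | no v≢i = WG.from-++-hit v P (e ∷ []) (Any-from⁻ v P (WG.start-left (WG.from-walk wP v∈P) v<i))
        where
        v<i : v < i
        v<i = ≤∧≢⇒< (proj₂ (WG.entered-inside wP v∈P)) (v≢i ∘ toℕ-injective)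

    side : ∀ {v P Q} → Walk G (s G) i P → Walk G j (t G) Q → InnerVertex G (P ++ e ∷ Q) v →
             (InnerVertex Gₑ (piece-t P) v × Any (WG.Enters v) P) ⊎ (InnerVertex Gₑ (piece-s Q) v × Any (WG.Enters v) (e ∷ Q))
    side {v} {P} {Q} wP wQ (v-entered , v-left) with ++⁻ P v-entered
    ... | inj₁ v∈P =
      inj₁ ((++⁺ˡ (enters-lift (e∉-before-i wP) v∈P) ,
             subst (Any (WM.Leaves v)) (sym (piece-t≡ P)) (leaves-lift v-leaves-Pe)) , v∈P)
      where
      v≤i : v ≤ i
      v≤i = proj₂ (WG.entered-inside wP v∈P)
      leaves-Pe : Any (WG.Leaves v) P ⊎ Any (WG.Leaves v) (e ∷ Q) → Any (WG.Leaves v) (P ++ e ∷ [])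
      leaves-Pe (inj₁ p) = ++⁺ˡ p
      leaves-Pe (inj₂ (here q)) = ++⁺ʳ P (here q)
      leaves-Pe (inj₂ (there p)) = ⊥-elim (<-irrefl refl (<-≤-trans (≤-<-trans v≤i (increasing e)) (proj₁ (WG.left-inside wQ p))))
      v-leaves-Pe : Any (WG.Leaves v) (P ++ e ∷ [])
      v-leaves-Pe = leaves-Pe (++⁻ P v-left)
    ... | inj₂ v∈e∷Q = inj₂ ((enters-piece-s v∈e∷Q , there (leaves-lift v-leaves-Q)) , v∈e∷Q)
      where
      i<v : i < v
      i<v = proj₁ (WG.entered-inside (cons refl wQ) v∈e∷Q)
      enters-piece-s : Any (WG.Enters v) (e ∷ Q) → Any (λ a → tgt Gₑ a ≡ v) (piece-s Q)
      enters-piece-s (here q) = here q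
      enters-piece-s (there p) = there (enters-lift (e∉-after-j wQ) p)
      leaves-Pe : Any (WG.Leaves v) P ⊎ Any (WG.Leaves v) (e ∷ Q) → Any (WG.Leaves v) Q
      leaves-Pe (inj₁ p) = ⊥-elim (<-irrefl refl (<-trans i<v (proj₂ (WG.left-inside wP p))))
      leaves-Pe (inj₂ (here q)) = ⊥-elim (WG.lt-ne i<v q)
      leaves-Pe (inj₂ (there p)) = p
      v-leaves-Q : Any (WG.Leaves v) Q
      v-leaves-Q = leaves-Pe (++⁻ P v-left)

    module AvoidingRoute {X v} (wX : Walk G (s G) (t G) X) (e∉X : e ∉ X) (v-X : InnerVertex G X v) where
      X′ : List Eₑ
      X′ = map suc X

      wX′ : Walk Gₑ (s G) (t G) X′
      wX′ = lift-walk wX e∉X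

      v-X′ : InnerVertex Gₑ X′ v
      v-X′ = enters-lift e∉X (proj₁ v-X) , leaves-lift (proj₂ v-X)

      up-X : map original (reverse (upTo Gₑ v X′)) ≡ reverse (upTo G v X)
      up-X = sym (LiftedPiece.up≡ e∉X v-X′)

      from-X : map original (from Gₑ v X′) ≡ from G v X
      from-X = sym (LiftedPiece.from≡ e∉X v-X′)

      e∉up-X : e ∉ reverse (upTo G v X)
      e∉up-X = e∉X ∘ Any-upTo⁻ v X ∘ AnyP.reverse⁻

      e∉from-X : e ∉ from G v X
      e∉from-X = e∉X ∘ Any-from⁻ v X

      lifted-incoherent : ∀ {R} → Walk G (s G) (t G) R → (e∉R : e ∉ R) (v-R′ : InnerVertex Gₑ (map suc R) v) →
                          Incoherent G F v X R → Incoherent Gₑ F′ v X′ (map suc R)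
      lifted-incoherent {R} wR e∉R v-R′ =
        Sum.map (λ (inLt , outLt) → Lex⇒InLtₑ wX′ wR′ v-X′ v-R′ up-X up-R (OG.InLt⇒Lex v X R refl refl inLt) ,
                                     Lex⇒OutLtₑ wR′ wX′ v-R′ v-X′ from-R from-X (OG.OutLt⇒Lex v R X refl refl outLt))
                (λ (inLt , outLt) → Lex⇒InLtₑ wR′ wX′ v-R′ v-X′ up-R up-X (OG.InLt⇒Lex v R X refl refl inLt) ,
                                     Lex⇒OutLtₑ wX′ wR′ v-X′ v-R′ from-X from-R (OG.OutLt⇒Lex v X R refl refl outLt))
        where
        wR′ : Walk Gₑ (s G) (t G) (map suc R)
        wR′ = lift-walk wR e∉R
        up-R = sym (LiftedPiece.up≡ e∉R v-R′)
        from-R = sym (LiftedPiece.from≡ e∉R v-R′)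

      t-piece-incoherent : ∀ {P Q} → Walk G (s G) i P → Walk G j (t G) Q →
                           InnerVertex Gₑ (piece-t P) v → Any (WG.Enters v) P →
                           Incoherent G F v X (P ++ e ∷ Q) → Incoherent Gₑ F′ v X′ (piece-t P)
      t-piece-incoherent {P} {Q} wP wQ v-T v∈P =
        Sum.map (λ (inLt , outLt) → Lex⇒InLtₑ wX′ wT v-X′ v-T up-X up-R (OG.InLt⇒Lex v X R refl refl inLt) ,
                                     Lex⇒OutLtₑ wT wX′ v-T v-X′ from-T from-X
                                       (OG.LexOut.Lex-truncateˡ e w Q (from G v X) e∉from-X (OG.OutLt⇒Lex v R X from-R refl outLt)))
                (λ (inLt , outLt) → Lex⇒InLtₑ wT wX′ v-T v-X′ up-R up-X (OG.InLt⇒Lex v R X refl refl inLt) ,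
                                     Lex⇒OutLtₑ wX′ wT v-X′ v-T from-X from-T
                                       (OG.LexOut.Lex-truncateʳ e w Q (from G v X) e∉from-X (OG.OutLt⇒Lex v X R refl from-R outLt)))
        where
        R : List E
        R = P ++ e ∷ Q
        wT : Walk Gₑ (s G) (t G) (piece-t P)
        wT = piece-t-walk wP
        w : List E
        w = from G v P
        from-T : map original (from Gₑ v (piece-t P)) ≡ w ++ e ∷ []
        from-T = proj₁ (from-piece-t wP v∈P)
        up-R = sym (TPiece.up≡ {Q = Q} wP wQ v-T)
        from-R : from G v R ≡ w ++ e ∷ Q
        from-R = trans (TPiece.from≡ {Q = Q} wP wQ v-T)
                       (trans (cong (_++ Q) from-T) (++-assoc w (e ∷ []) Q))

      s-piece-incoherent : ∀ {P Q} → Walk G (s G) i P → Walk G j (t G) Q → InnerVertex Gₑ (piece-s Q) v →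
                           Incoherent G F v X (P ++ e ∷ Q) → Incoherent Gₑ F′ v X′ (piece-s Q)
      s-piece-incoherent {P} {Q} wP wQ v-S =
        Sum.map (λ (inLt , outLt) → Lex⇒InLtₑ wX′ wS v-X′ v-S up-X up-S
                                       (OG.LexIn.Lex-truncateʳ e w (reverse P) _ e∉up-X (OG.InLt⇒Lex v X R refl up-R inLt)) ,
                                     Lex⇒OutLtₑ wS wX′ v-S v-X′ from-R from-X (OG.OutLt⇒Lex v R X refl refl outLt))
                (λ (inLt , outLt) → Lex⇒InLtₑ wS wX′ v-S v-X′ up-S up-X
                                       (OG.LexIn.Lex-truncateˡ e w (reverse P) _ e∉up-X (OG.InLt⇒Lex v R X up-R refl inLt)) ,
                                     Lex⇒OutLtₑ wX′ wS v-X′ v-S from-X from-R (OG.OutLt⇒Lex v X R refl refl outLt))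
        where
        R : List E
        R = P ++ e ∷ Q
        wS : Walk Gₑ (s G) (t G) (piece-s Q)
        wS = piece-s-walk wQ
        w : List E
        w = before-e wQ
        up-S : map original (reverse (upTo Gₑ v (piece-s Q))) ≡ w ++ e ∷ []
        up-S = piece-s-before-e wQ
        up-R : reverse (upTo G v R) ≡ w ++ e ∷ reverse P
        up-R = trans (SPiece.up≡ {P = P} wP wQ v-S)
                     (trans (cong (_++ reverse P) up-S) (++-assoc w (e ∷ []) (reverse P)))
        from-R = sym (SPiece.from≡ {P = P} wP wQ v-S)

    avoiding-coherent : ∀ {X R} → Walk G (s G) (t G) X → e ∉ X → Walk G (s G) (t G) R →
                        (∀ p → p ∈ φ G e R → Coherent Gₑ F′ (map suc X) p) → Coherent G F X R
    avoiding-coherent wX e∉X wR coh v v-X v-R incoh with route-shape wR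
    ... | avoiding R wR e∉R =
      coh (map suc R) (lift∈φ e∉R) v v-X′ v-R′ (lifted-incoherent wR e∉R v-R′ incoh)
      where
      open AvoidingRoute wX e∉X v-X
      v-R′ : InnerVertex Gₑ (map suc R) v
      v-R′ = enters-lift e∉R (proj₁ v-R) , leaves-lift (proj₂ v-R)
    ... | through P Q wP wQ with side wP wQ v-R
    ...   | inj₁ (v-T , v∈P) = coh (piece-t P) (piece-t∈φ wP wQ) v v-X′ v-T (t-piece-incoherent wP wQ v-T v∈P incoh)
      where open AvoidingRoute wX e∉X v-X
    ...   | inj₂ (v-S , _) = coh (piece-s Q) (piece-s∈φ wP wQ) v v-X′ v-S (s-piece-incoherent wP wQ v-S incoh)
      where open AvoidingRoute wX e∉X v-X

    reverse-upTo-i : ∀ {P Q} → Walk G (s G) i P → Walk G j (t G) Q → reverse (upTo G i (P ++ e ∷ Q)) ≡ reverse P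
    reverse-upTo-i {P} {Q} wP wQ = cong reverse (WG.upTo-exit (WG.split P e Q refl wP wQ) refl s<i)

    from-i : ∀ {P Q} → Walk G (s G) i P → Walk G j (t G) Q → from G i (P ++ e ∷ Q) ≡ e ∷ Q
    from-i {P} {Q} wP wQ = WG.from-exit (WG.split P e Q refl wP wQ) refl

    inverted-on-t-side : ∀ {v P Q P′ Q′} → Walk G (s G) i P → Walk G j (t G) Q → Walk G (s G) i P′ → Walk G j (t G) Q′ →
      InnerVertex Gₑ (piece-t P) v → Any (WG.Enters v) P → InnerVertex Gₑ (piece-t P′) v → Any (WG.Enters v) P′ →
      OG.Inverted v (P ++ e ∷ Q) (P′ ++ e ∷ Q′) →
      OM.Inverted v (piece-t P) (piece-t P′) ⊎ OG.Inverted i (P ++ e ∷ Q) (P′ ++ e ∷ Q′)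
    inverted-on-t-side {v} {P} {Q} {P′} {Q′} wP wQ wP′ wQ′ iT v∈P iT′ v∈P′ (inLt , outLt) =
      dispatch (OG.LexOut.Lex-split e w′ Q′ w Q (proj₂ (from-piece-t wP′ v∈P′)) (proj₂ (from-piece-t wP v∈P))
                                    (OG.OutLt⇒Lex v R′ R from-R′ from-R outLt))
      where
      R : List E
      R = P ++ e ∷ Q
      R′ : List E
      R′ = P′ ++ e ∷ Q′
      w : List E
      w = from G v P
      w′ : List E
      w′ = from G v P′
      from-R : from G v R ≡ w ++ e ∷ Q
      from-R = trans (TPiece.from≡ {Q = Q} wP wQ iT) (trans (cong (_++ Q) (proj₁ (from-piece-t wP v∈P))) (++-assoc w (e ∷ []) Q))
      from-R′ : from G v R′ ≡ w′ ++ e ∷ Q′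
      from-R′ = trans (TPiece.from≡ {Q = Q′} wP′ wQ′ iT′)
                      (trans (cong (_++ Q′) (proj₁ (from-piece-t wP′ v∈P′))) (++-assoc w′ (e ∷ []) Q′))
      reverse-P : ∀ {P} → Walk G (s G) i P → Any (WG.Enters v) P → reverse P ≡ reverse (from G v P) ++ reverse (upTo G v P)
      reverse-P {P} wP v∈P = trans (cong reverse (WG.upTo-++-from wP v∈P)) (reverse-++ (upTo G v P) (from G v P))
      dispatch : OG.LexOut.Lex (w′ ++ e ∷ []) (w ++ e ∷ []) ⊎ (w′ ≡ w × OG.LexOut.Lex Q′ Q) →
                 OM.Inverted v (piece-t P) (piece-t P′) ⊎ OG.Inverted i R R′
      dispatch (inj₁ c) =
        inj₁ (Lex⇒InLtₑ (piece-t-walk wP) (piece-t-walk wP′) iT iT′ (sym (TPiece.up≡ {Q = Q} wP wQ iT))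
                        (sym (TPiece.up≡ {Q = Q′} wP′ wQ′ iT′)) (OG.InLt⇒Lex v R R′ refl refl inLt) ,
              Lex⇒OutLtₑ (piece-t-walk wP′) (piece-t-walk wP) iT′ iT
                         (proj₁ (from-piece-t wP′ v∈P′)) (proj₁ (from-piece-t wP v∈P)) c)
      dispatch (inj₂ (w′≡w , c)) =
        inj₂ (OG.Lex⇒InLt i R R′ (reverse-upTo-i wP wQ) (reverse-upTo-i wP′ wQ′)
                (subst₂ OG.LexIn.Lex (sym (reverse-P wP v∈P))
                        (sym (trans (reverse-P wP′ v∈P′) (cong (λ u → reverse u ++ reverse (upTo G v P′)) w′≡w)))
                  (OG.LexIn.Lex-++ˡ (reverse w) (reverse (upTo G v P)) (reverse (upTo G v P′))
                    (OG.InLt⇒Lex v R R′ (cong reverse (WG.upTo-++-hit v P (e ∷ Q) v∈P))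
                                        (cong reverse (WG.upTo-++-hit v P′ (e ∷ Q′) v∈P′)) inLt))) ,
              OG.Lex⇒OutLt i R′ R (from-i wP′ wQ′) (from-i wP wQ) (OG.LexOut.Lex-∷⁺ e Q′ Q c))

    inverted-on-s-side : ∀ {v P Q P′ Q′} → Walk G (s G) i P → Walk G j (t G) Q → Walk G (s G) i P′ → Walk G j (t G) Q′ →
      InnerVertex Gₑ (piece-s Q) v → Any (WG.Enters v) (e ∷ Q) →
      InnerVertex Gₑ (piece-s Q′) v → Any (WG.Enters v) (e ∷ Q′) →
      OG.Inverted v (P ++ e ∷ Q) (P′ ++ e ∷ Q′) →
      OM.Inverted v (piece-s Q) (piece-s Q′) ⊎ OG.Inverted i (P ++ e ∷ Q) (P′ ++ e ∷ Q′)
    inverted-on-s-side {v} {P} {Q} {P′} {Q′} wP wQ wP′ wQ′ iS v∈eQ iS′ v∈eQ′ (inLt , outLt) =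
      dispatch (OG.LexIn.Lex-split e w (reverse P) w′ (reverse P′) (e∉before-e wQ) (e∉before-e wQ′)
                                   (OG.InLt⇒Lex v R R′ (up-R wP wQ iS) (up-R wP′ wQ′ iS′) inLt))
      where
      R : List E
      R = P ++ e ∷ Q
      R′ : List E
      R′ = P′ ++ e ∷ Q′
      w : List E
      w = before-e wQ
      w′ : List E
      w′ = before-e wQ′
      up-R : ∀ {P Q} → Walk G (s G) i P → (wQ : Walk G j (t G) Q) → InnerVertex Gₑ (piece-s Q) v →
             reverse (upTo G v (P ++ e ∷ Q)) ≡ before-e wQ ++ e ∷ reverse P
      up-R {P} {Q} wP wQ iS = trans (SPiece.up≡ {P = P} wP wQ iS)
                                    (trans (cong (_++ reverse P) (piece-s-before-e wQ)) (++-assoc (before-e wQ) (e ∷ []) (reverse P)))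
      e∷Q≡ : ∀ {P Q} → Walk G (s G) i P → Walk G j (t G) Q → Any (WG.Enters v) (e ∷ Q) →
             e ∷ Q ≡ upTo G v (e ∷ Q) ++ from G v (P ++ e ∷ Q)
      e∷Q≡ {P} {Q} wP wQ v∈eQ =
        trans (WG.upTo-++-from (cons refl wQ) v∈eQ)
              (cong (upTo G v (e ∷ Q) ++_) (sym (WG.from-++-miss v P (e ∷ Q) (WG.not-left-beyond wP (<⇒≤ i<v)))))
        where
        i<v = proj₁ (WG.entered-inside (cons refl wQ) v∈eQ)
      dispatch : OG.LexIn.Lex (w ++ e ∷ []) (w′ ++ e ∷ []) ⊎ (w ≡ w′ × OG.LexIn.Lex (reverse P) (reverse P′)) →
                 OM.Inverted v (piece-s Q) (piece-s Q′) ⊎ OG.Inverted i R R′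
      dispatch (inj₁ c) =
        inj₁ (Lex⇒InLtₑ (piece-s-walk wQ) (piece-s-walk wQ′) iS iS′ (piece-s-before-e wQ) (piece-s-before-e wQ′) c ,
              Lex⇒OutLtₑ (piece-s-walk wQ′) (piece-s-walk wQ) iS′ iS
                (sym (SPiece.from≡ {P = P′} wP′ wQ′ iS′)) (sym (SPiece.from≡ {P = P} wP wQ iS))
                (OG.OutLt⇒Lex v R′ R refl refl outLt))
      dispatch (inj₂ (w≡w′ , c)) =
        inj₂ (OG.Lex⇒InLt i R R′ (reverse-upTo-i wP wQ) (reverse-upTo-i wP′ wQ′) c ,
              OG.Lex⇒OutLt i R′ R (from-i wP′ wQ′) (from-i wP wQ)
                (subst₂ OG.LexOut.Lex (sym (trans (e∷Q≡ wP′ wQ′ v∈eQ′) (cong (_++ from G v R′) (sym same-prefix))))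
                                      (sym (e∷Q≡ wP wQ v∈eQ))
                  (OG.LexOut.Lex-++ˡ (upTo G v (e ∷ Q)) (from G v R′) (from G v R) (OG.OutLt⇒Lex v R′ R refl refl outLt))))
        where
        same-prefix : upTo G v (e ∷ Q) ≡ upTo G v (e ∷ Q′)
        same-prefix =
          reverse-injective (trans (reverse-upTo-e∷≡ wQ) (trans (cong (_++ e ∷ []) w≡w′) (sym (reverse-upTo-e∷≡ wQ′))))

    through-coherent : ∀ {P Q P′ Q′} → Walk G (s G) i P → Walk G j (t G) Q → Walk G (s G) i P′ → Walk G j (t G) Q′ →
                       Coherent Gₑ F′ (piece-s Q) (piece-s Q′) → Coherent Gₑ F′ (piece-t P) (piece-t P′) →
                       ¬ Incoherent G F i (P ++ e ∷ Q) (P′ ++ e ∷ Q′) → Coherent G F (P ++ e ∷ Q) (P′ ++ e ∷ Q′)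
    through-coherent wP wQ wP′ wQ′ coh-s coh-t coh-i v v-R v-R′ incoh with side wP wQ v-R | side wP′ wQ′ v-R′
    ... | inj₁ (_ , v∈P) | inj₂ (_ , v∈eQ′) =
      <-irrefl refl (<-≤-trans (proj₁ (WG.entered-inside (cons refl wQ′) v∈eQ′)) (proj₂ (WG.entered-inside wP v∈P)))
    ... | inj₂ (_ , v∈eQ) | inj₁ (_ , v∈P′) =
      <-irrefl refl (<-≤-trans (proj₁ (WG.entered-inside (cons refl wQ) v∈eQ)) (proj₂ (WG.entered-inside wP′ v∈P′)))
    ... | inj₁ (iT , v∈P) | inj₁ (iT′ , v∈P′) =
      Sum.[ Sum.[ coh-t v iT iT′ ∘ inj₁ , coh-i ∘ inj₁ ] ∘ inverted-on-t-side wP wQ wP′ wQ′ iT v∈P iT′ v∈P′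
          , Sum.[ coh-t v iT iT′ ∘ inj₂ , coh-i ∘ inj₂ ] ∘ inverted-on-t-side wP′ wQ′ wP wQ iT′ v∈P′ iT v∈P ] incoh
    ... | inj₂ (iS , v∈eQ) | inj₂ (iS′ , v∈eQ′) =
      Sum.[ Sum.[ coh-s v iS iS′ ∘ inj₁ , coh-i ∘ inj₁ ] ∘ inverted-on-s-side wP wQ wP′ wQ′ iS v∈eQ iS′ v∈eQ′
          , Sum.[ coh-s v iS iS′ ∘ inj₂ , coh-i ∘ inj₂ ] ∘ inverted-on-s-side wP′ wQ′ wP wQ iS′ v∈eQ′ iS v∈eQ ] incoh

module Covering where

  open import Data.Fin using (Fin; _≟_; suc)
  open import Data.List using (List; []; _∷_; _++_; map; reverse; filter)
  open import Data.List.Membership.Propositional using (_∈_; find; lose)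
  open import Data.List.Membership.Propositional.Properties using (∈-concatMap⁺; ∈-concatMap⁻; ∈-filter⁺; ∈-filter⁻)
  open import Data.List.Relation.Unary.Any using (here; there)
  open import Data.List.Relation.Unary.All using (lookup)
  open import Data.Product using (Σ-syntax; _×_; _,_; proj₁; proj₂)
  import Data.Sum as Sum
  open import Function using (_∘_)
  open import Relation.Nullary using (¬_; yes; no; Dec)
  open import Relation.Binary.PropositionalEquality using (_≡_; refl; sym; trans; cong₂; subst; subst₂)
  open import Defs
  import Data.List.Membership.DecPropositional as DecMembership
  open Walks
  open FramingOrders
  open Staircase
  open Extension
  open SplitGraph
  open SplitCoherence

  module Cover (G : Graph) (fg : IsFlowGraph G) (F : Framing G) (e : Fin (m G)) (ie : InnerEdge G e)
               (F′ : Framing (M G e)) (inh : Inherits G F e F′) where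
    open IsFlowGraph fg using (increasing)
    open Splitting G fg e ie
    open PieceCoherence G fg F e ie F′ inh
    open Plane OG.LexIn.Lex OG.LexOut.Lex

    ∈Φ⁺ : ∀ {A R p} → R ∈ A → p ∈ φ G e R → p ∈ Φ G e A
    ∈Φ⁺ R∈A p∈φR = ∈-concatMap⁺ (φ G e) (lose R∈A p∈φR)

    ∈Φ⁻ : ∀ {A p} → p ∈ Φ G e A → Σ[ R ∈ List E ] R ∈ A × p ∈ φ G e R
    ∈Φ⁻ {A} p∈ΦA = find (∈-concatMap⁻ (φ G e) {xs = A} p∈ΦA)

    split-through-e : ∀ {R} → Walk G (s G) (t G) R → e ∈ R →
                      Walk G (s G) i (upTo G i R) × Walk G j (t G) (from G j R) × R ≡ upTo G i R ++ e ∷ from G j R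
    split-through-e {R} wR e∈R with WG.split-at wR e∈R
    ... | σ@(WG.split P x Q R≡ wP wQ) , refl =
      subst (Walk G (s G) i) (sym up≡) wP , subst (Walk G j (t G)) (sym from≡) wQ ,
      trans R≡ (sym (cong₂ (λ P′ Q′ → P′ ++ e ∷ Q′) up≡ from≡))
      where
      up≡ : upTo G i R ≡ P
      up≡ = WG.upTo-exit σ refl s<i
      from≡ : from G j R ≡ Q
      from≡ = WG.from-entry σ refl

    incoherent-at-i⇒crossing : ∀ {P Q P′ Q′} → Walk G (s G) i P → Walk G j (t G) Q →
                               Walk G (s G) i P′ → Walk G j (t G) Q′ →
      Incoherent G F i (P ++ e ∷ Q) (P′ ++ e ∷ Q′) → Crosses (reverse P) Q (reverse P′) Q′
    incoherent-at-i⇒crossing {P} {Q} {P′} {Q′} wP wQ wP′ wQ′ = Sum.map (inverted wP wQ wP′ wQ′) (inverted wP′ wQ′ wP wQ)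
      where
      inverted : ∀ {P Q P′ Q′} → Walk G (s G) i P → Walk G j (t G) Q → Walk G (s G) i P′ → Walk G j (t G) Q′ →
                 OG.Inverted i (P ++ e ∷ Q) (P′ ++ e ∷ Q′) → OG.LexIn.Lex (reverse P) (reverse P′) × OG.LexOut.Lex Q′ Q
      inverted {P} {Q} {P′} {Q′} wP wQ wP′ wQ′ (inLt , outLt) =
        OG.InLt⇒Lex i (P ++ e ∷ Q) (P′ ++ e ∷ Q′) (reverse-upTo-i wP wQ) (reverse-upTo-i wP′ wQ′) inLt ,
        OG.LexOut.Lex-∷⁻ e Q′ Q (OG.OutLt⇒Lex i (P′ ++ e ∷ Q′) (P ++ e ∷ Q) (from-i wP′ wQ′) (from-i wP wQ) outLt)

    crossing⇒incoherent-at-i : ∀ {P Q P′ Q′} → Walk G (s G) i P → Walk G j (t G) Q →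
                               Walk G (s G) i P′ → Walk G j (t G) Q′ →
      Crosses (reverse P) Q (reverse P′) Q′ → Incoherent G F i (P ++ e ∷ Q) (P′ ++ e ∷ Q′)
    crossing⇒incoherent-at-i {P} {Q} {P′} {Q′} wP wQ wP′ wQ′ = Sum.map (inverted wP wQ wP′ wQ′) (inverted wP′ wQ′ wP wQ)
      where
      inverted : ∀ {P Q P′ Q′} → Walk G (s G) i P → Walk G j (t G) Q → Walk G (s G) i P′ → Walk G j (t G) Q′ →
                 OG.LexIn.Lex (reverse P) (reverse P′) × OG.LexOut.Lex Q′ Q → OG.Inverted i (P ++ e ∷ Q) (P′ ++ e ∷ Q′)
      inverted {P} {Q} {P′} {Q′} wP wQ wP′ wQ′ (P<P′ , Q′<Q) =
        OG.Lex⇒InLt i (P ++ e ∷ Q) (P′ ++ e ∷ Q′) (reverse-upTo-i wP wQ) (reverse-upTo-i wP′ wQ′) P<P′ ,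
        OG.Lex⇒OutLt i (P′ ++ e ∷ Q′) (P ++ e ∷ Q) (from-i wP′ wQ′) (from-i wP wQ) (OG.LexOut.Lex-∷⁺ e Q′ Q Q′<Q)

    PiecesCoherentWith : List (List Eₑ) → List E → Set
    PiecesCoherentWith B Z = ∀ p → p ∈ φ G e Z → ∀ Y → Y ∈ B → Coherent Gₑ F′ p Y

    pieces-coherent : ∀ {B P Q} → Walk G (s G) i P → Walk G j (t G) Q →
                      (∀ Y → Y ∈ B → Coherent Gₑ F′ (piece-s Q) Y) →
                      (∀ Y → Y ∈ B → Coherent Gₑ F′ (piece-t P) Y) →
                      PiecesCoherentWith B (P ++ e ∷ Q)
    pieces-coherent wP wQ coh-s coh-t p p∈ with subst (p ∈_) (φ-through-split wP wQ) p∈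
    ... | here refl = coh-s
    ... | there (here refl) = coh-t

    Saturated : List (List E) → List (List Eₑ) → Set
    Saturated A B = ∀ Z → Walk G (s G) (t G) Z → (∀ R → R ∈ A → Coherent G F Z R) → PiecesCoherentWith B Z → Z ∈ A

    module _ (A : List (List E)) (A-clique : IsClique G F A) (B : List (List Eₑ)) (B-clique : IsClique Gₑ F′ B)
             (Φ⊆B : ∀ {p} → p ∈ Φ G e A → p ∈ B) (saturated : Saturated A B) where

      private
        routeA : ∀ {R} → R ∈ A → Walk G (s G) (t G) R
        routeA = lookup (proj₁ A-clique)

        cohA : ∀ {R R′} → R ∈ A → R′ ∈ A → Coherent G F R R′
        cohA R∈ R′∈ = proj₂ A-clique _ _ R∈ R′∈

        cohB : ∀ {Y} → Y ∈ B → ∀ Y′ → Y′ ∈ B → Coherent Gₑ F′ Y Y′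
        cohB Y∈ Y′ Y′∈ = proj₂ B-clique _ Y′ Y∈ Y′∈

        through? : ∀ R → Dec (e ∈ R)
        through? = DecMembership._∈?_ _≟_ e

        Aₑ : List (List E)
        Aₑ = filter through? A

        in-Aₑ : ∀ {L R} → Aₑ ≡ L → R ∈ L → R ∈ Aₑ
        in-Aₑ Aₑ≡L R∈L = subst (_ ∈_) (sym Aₑ≡L) R∈L

        through-in-A : ∀ {R} → R ∈ Aₑ → R ∈ A × e ∈ R
        through-in-A = ∈-filter⁻ through? {xs = A}

      Aₑ-noncrossing : ∀ R R′ → R ∈ Aₑ → R′ ∈ Aₑ →
                       ¬ Crosses (reverse (upTo G i R)) (from G j R) (reverse (upTo G i R′)) (from G j R′)
      Aₑ-noncrossing R R′ R∈ R′∈ crossing with through-in-A R∈ | through-in-A R′∈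
      ... | R∈A , e∈R | R′∈A , e∈R′ with split-through-e (routeA R∈A) e∈R | split-through-e (routeA R′∈A) e∈R′
      ...   | wP , wQ , R≡ | wP′ , wQ′ , R′≡ =
        subst₂ (Coherent G F) R≡ R′≡ (cohA R∈A R′∈A) i (inner-i wP wQ) (inner-i wP′ wQ′)
          (crossing⇒incoherent-at-i wP wQ wP′ wQ′ crossing)
        where
        inner-i : ∀ {P Q} → Walk G (s G) i P → Walk G j (t G) Q → InnerVertex G (P ++ e ∷ Q) i
        inner-i {P} {Q} wP wQ = WG.inner-exit (WG.split P e Q refl wP wQ) refl s<i

      piece-in-B : ∀ {R p} → R ∈ A → p ∈ φ G e R → p ∈ B
      piece-in-B R∈A p∈φR = Φ⊆B (∈Φ⁺ R∈A p∈φR)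

      piece-s-in-B : ∀ {R} → R ∈ A → e ∈ R → piece-s (from G j R) ∈ B
      piece-s-in-B {R} R∈A e∈R = piece-in-B R∈A (subst (piece-s (from G j R) ∈_) (sym (φ-through R e∈R)) (here refl))

      piece-t-in-B : ∀ {R} → R ∈ A → e ∈ R → piece-t (upTo G i R) ∈ B
      piece-t-in-B {R} R∈A e∈R = piece-in-B R∈A (subst (piece-t (upTo G i R) ∈_) (sym (φ-through R e∈R)) (there (here refl)))

      completion-in-A : ∀ {P Q} → Walk G (s G) i P → Walk G j (t G) Q → PiecesCoherentWith B (P ++ e ∷ Q) →
                        (∀ R → R ∈ A → e ∈ R → ¬ Incoherent G F i (P ++ e ∷ Q) (upTo G i R ++ e ∷ from G j R)) →
                        P ++ e ∷ Q ∈ A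
      completion-in-A {P} {Q} wP wQ pieces-coh coh-at-i = saturated _ (WG.walk-++ wP (cons refl wQ)) coherent pieces-coh
        where
        coherent : ∀ R → R ∈ A → Coherent G F (P ++ e ∷ Q) R
        coherent R R∈A with through? R
        ... | no e∉R =
          OG.Coherent-sym (avoiding-coherent (routeA R∈A) e∉R (WG.walk-++ wP (cons refl wQ))
            (λ p p∈ → OM.Coherent-sym (pieces-coh p p∈ (map suc R) (piece-in-B R∈A (lift∈φ e∉R)))))
        ... | yes e∈R with split-through-e (routeA R∈A) e∈R
        ...   | wP′ , wQ′ , R≡ =
          subst (Coherent G F (P ++ e ∷ Q)) (sym R≡)
            (through-coherent wP wQ wP′ wQ′
               (pieces-coh (piece-s Q) (piece-s∈φ wP wQ) _ (piece-s-in-B R∈A e∈R))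
               (pieces-coh (piece-t P) (piece-t∈φ wP wQ) _ (piece-t-in-B R∈A e∈R))
               (coh-at-i R R∈A e∈R))

      private
        no-route-through-e : ∀ {Z} → Aₑ ≡ [] → ∀ R → R ∈ A → e ∈ R →
                             ¬ Incoherent G F i Z (upTo G i R ++ e ∷ from G j R)
        no-route-through-e none R R∈A e∈R _ with subst (R ∈_) none (∈-filter⁺ through? R∈A e∈R)
        ... | ()

      module Extensions = Extend Gₑ F′ increasingₑ

      s-piece-covered : ∀ {Q} → Walk G j (t G) Q → piece-s Q ∈ B → piece-s Q ∈ Φ G e A
      s-piece-covered {Q} wQ Y∈B with Aₑ in through-e
      ... | [] with Extensions.Backward.backward-extension has-entryₑ B B-clique (e-t e) tgtₑ-e-t
      ...   | P′ , wP′ , P′-coh with lower-walk wP′ (e-s∉-before-j wP′ (increasing e)) (e-t∉-before-t wP′ i<t)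
      ...     | P , refl , _ , wP =
        ∈Φ⁺ (completion-in-A wP wQ (pieces-coherent wP wQ (cohB Y∈B) P′-coh)
                             (λ R → no-route-through-e {P ++ e ∷ Q} through-e R))
            (piece-s∈φ wP wQ)
      s-piece-covered {Q} wQ Y∈B | R₀ ∷ Rs
        with uncrossed-at (reverse ∘ upTo G i) (from G j) (λ {x} {y} {z} → OG.LexIn.Lex-trans x y z) (λ {x} → OG.LexIn.Lex-irrefl x)
                          OG.LexIn.Lex? (λ {x} {y} {z} → OG.LexOut.Lex-trans x y z) OG.LexOut.Lex? R₀ Rs
                          (λ R R′ R∈ R′∈ → Aₑ-noncrossing R R′ (in-Aₑ through-e R∈) (in-Aₑ through-e R′∈)) Q
      ... | a , a∈ , a-uncrossed with through-in-A (in-Aₑ through-e a∈)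
      ...   | a∈A , e∈a with split-through-e (routeA a∈A) e∈a
      ...     | wPa , _ =
        ∈Φ⁺ (completion-in-A wPa wQ (pieces-coherent wPa wQ (cohB Y∈B) (cohB (piece-t-in-B a∈A e∈a))) coh-at-i)
            (piece-s∈φ wPa wQ)
        where
        coh-at-i : ∀ R → R ∈ A → e ∈ R → ¬ Incoherent G F i (upTo G i a ++ e ∷ Q) (upTo G i R ++ e ∷ from G j R)
        coh-at-i R R∈A e∈R incoh with split-through-e (routeA R∈A) e∈R
        ... | wPR , wQR , _ =
          a-uncrossed R (subst (R ∈_) through-e (∈-filter⁺ through? R∈A e∈R))
            (incoherent-at-i⇒crossing wPa wQ wPR wQR incoh)

      t-piece-covered : ∀ {P} → Walk G (s G) i P → piece-t P ∈ B → piece-t P ∈ Φ G e A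
      t-piece-covered {P} wP Y∈B with Aₑ in through-e
      ... | [] with Extensions.Forward.forward-extension has-exitₑ B B-clique e-s refl
      ...   | Q′ , wQ′ , Q′-coh with lower-walk wQ′ (e-s∉ wQ′ s<j) (e-t∉-after-i wQ′ (increasing e))
      ...     | Q , refl , _ , wQ =
        ∈Φ⁺ (completion-in-A wP wQ (pieces-coherent wP wQ Q′-coh (cohB Y∈B))
                             (λ R → no-route-through-e {P ++ e ∷ Q} through-e R))
            (piece-t∈φ wP wQ)
      t-piece-covered {P} wP Y∈B | R₀ ∷ Rs
        with Plane.uncrossed-at OG.LexOut.Lex OG.LexIn.Lex (from G j) (reverse ∘ upTo G i)
               (λ {x} {y} {z} → OG.LexOut.Lex-trans x y z) (λ {x} → OG.LexOut.Lex-irrefl x) OG.LexOut.Lex?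
               (λ {x} {y} {z} → OG.LexIn.Lex-trans x y z) OG.LexIn.Lex? R₀ Rs
               (λ R R′ R∈ R′∈ → Aₑ-noncrossing R R′ (in-Aₑ through-e R∈) (in-Aₑ through-e R′∈)
                                ∘ Crosses-transpose OG.LexOut.Lex OG.LexIn.Lex (from G j R) (reverse (upTo G i R))
                                                    (from G j R′) (reverse (upTo G i R′)))
               (reverse P)
      ... | a , a∈ , a-uncrossed with through-in-A (in-Aₑ through-e a∈)
      ...   | a∈A , e∈a with split-through-e (routeA a∈A) e∈a
      ...     | _ , wQa , _ =
        ∈Φ⁺ (completion-in-A wP wQa (pieces-coherent wP wQa (cohB (piece-s-in-B a∈A e∈a)) (cohB Y∈B)) coh-at-i)
            (piece-t∈φ wP wQa)
        where
        coh-at-i : ∀ R → R ∈ A → e ∈ R → ¬ Incoherent G F i (P ++ e ∷ from G j a) (upTo G i R ++ e ∷ from G j R)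
        coh-at-i R R∈A e∈R incoh with split-through-e (routeA R∈A) e∈R
        ... | wPR , wQR , _ =
          a-uncrossed R (subst (R ∈_) through-e (∈-filter⁺ through? R∈A e∈R))
            (Crosses-transpose OG.LexIn.Lex OG.LexOut.Lex (reverse P) (from G j a) (reverse (upTo G i R)) (from G j R)
              (incoherent-at-i⇒crossing wP wQa wPR wQR incoh))

      covered-by-Φ : ∀ {Y} → Y ∈ B → Y ∈ Φ G e A
      covered-by-Φ Y∈B with route-view (lookup (proj₁ B-clique) Y∈B)
      ... | via-s Q wQ = s-piece-covered wQ Y∈B
      ... | via-t P wP = t-piece-covered wP Y∈B
      ... | unsplit X wX e∉X = ∈Φ⁺ (saturated X wX X-coherent X-pieces) (lift∈φ e∉X)
        where
        X-coherent : ∀ R → R ∈ A → Coherent G F X R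
        X-coherent R R∈A = avoiding-coherent wX e∉X (routeA R∈A) (λ p p∈ → cohB Y∈B p (piece-in-B R∈A p∈))
        X-pieces : PiecesCoherentWith B X
        X-pieces p p∈ with subst (p ∈_) (φ-avoiding X e∉X) p∈
        ... | here refl = cohB Y∈B

open import Data.Fin using (Fin; suc; _≟_)
open import Data.List using (List; []; _∷_; _++_; map; drop; concatMap)
open import Data.List.Properties using (++-assoc; map-++; ≡-dec)
open import Data.List.Membership.Propositional using (_∈_; lose)
open import Data.List.Membership.Propositional.Properties using (∈-map⁺; ∈-concatMap⁺)
open import Data.List.Relation.Unary.All using (All; _∷_; []; lookup; all?; tabulate)
open import Data.List.Relation.Unary.Any.Properties using (++⁺ˡ; ++⁺ʳ)
open import Data.Product using (∃; _×_; _,_; proj₁; proj₂)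
open import Relation.Nullary using (Dec)
open import Relation.Nullary.Decidable using (_×-dec_)
open import Relation.Binary.PropositionalEquality using (_≡_; trans; cong; cong₂; subst)
open import Defs
import Data.List.Membership.DecPropositional as DecMembership
open FramingOrders
open SplitGraph
open SplitCoherence
open Covering
open GreedySubfamily

module SplitMaximality (G : Graph) (fg : IsFlowGraph G) (F : Framing G) (e : Fin (m G)) (ie : InnerEdge G e)
                       (F′ : Framing (M G e)) (inh : Inherits G F e F′) where
  open Splitting G fg e ie
  open PieceCoherence G fg F e ie F′ inh
  open Cover G fg F e ie F′ inh

  Φ-preserves-maximality : ∀ A → IsMaxClique G F A → IsMaxClique Gₑ F′ (Φ G e A)
  Φ-preserves-maximality A A-max@((A-routes , A-coherent) , _) = (tabulate routes , pairwise) , maximal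
    where
    routes : ∀ {p} → p ∈ Φ G e A → IsRoute Gₑ p
    routes p∈ with ∈Φ⁻ p∈
    ... | R , R∈A , p∈φR = piece-walk (lookup A-routes R∈A) p∈φR
    pairwise : ∀ p p′ → p ∈ Φ G e A → p′ ∈ Φ G e A → Coherent Gₑ F′ p p′
    pairwise p p′ p∈ p′∈ with ∈Φ⁻ p∈ | ∈Φ⁻ p′∈
    ... | R , R∈A , p∈φR | R′ , R′∈A , p′∈φR′ =
      φ-coherent (lookup A-routes R∈A) (lookup A-routes R′∈A) (A-coherent R R′ R∈A R′∈A) p∈φR p′∈φR′
    maximal : ∀ B → IsClique Gₑ F′ B → (∀ {p} → p ∈ Φ G e A → p ∈ B) → ∀ {Y} → Y ∈ B → Y ∈ Φ G e A
    maximal B B-clique Φ⊆B =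
      covered-by-Φ A (proj₁ A-max) B B-clique Φ⊆B (λ Z wZ Z-coherent _ → OG.maximal-absorbs A-max wZ Z-coherent)

  module Preimage (B : List (List Eₑ)) (B-max : IsMaxClique Gₑ F′ B) where
    B-clique : IsClique Gₑ F′ B
    B-clique = proj₁ B-max

    PiecesIn : List E → Set
    PiecesIn Z = IsRoute G Z × All (_∈ B) (φ G e Z)

    pieces-in? : ∀ Z → Dec (PiecesIn Z)
    pieces-in? Z = walk? G (s G) (t G) Z ×-dec all? (λ p → DecMembership._∈?_ (≡-dec _≟_) p B) (φ G e Z)

    open Greedy PiecesIn pieces-in? (Coherent G F) OG.Coherent? OG.Coherent-refl OG.Coherent-sym

    -- A route whose pieces lie in B is the image of its lift, or is glued from its two pieces.
    candidates : List (List E)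
    candidates = map (map original) B ++ concatMap (λ Y → map (λ Y′ → map original Y ++ drop 1 (map original Y′)) B) B

    candidates-complete : ∀ {Z} → PiecesIn Z → Z ∈ candidates
    candidates-complete (wZ , pieces∈B) with route-shape wZ
    ... | avoiding X wX e∉X with subst (All (_∈ B)) (φ-avoiding X e∉X) pieces∈B
    ...   | X∈B ∷ [] = ++⁺ˡ (subst (_∈ map (map original) B) (original-suc X) (∈-map⁺ (map original) X∈B))
    candidates-complete (wZ , pieces∈B) | through P Q wP wQ with subst (All (_∈ B)) (φ-through-split wP wQ) pieces∈B
    ... | s∈B ∷ t∈B ∷ [] =
      ++⁺ʳ (map (map original) B) (∈-concatMap⁺ _ (lose t∈B (subst (_∈ _) glue (∈-map⁺ _ s∈B))))
      where
      glue : map original (piece-t P) ++ drop 1 (map original (piece-s Q)) ≡ P ++ e ∷ Q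
      glue = trans (cong₂ _++_ (trans (map-++ original (map suc P) (e-t e ∷ [])) (cong (_++ e ∷ []) (original-suc P)))
                               (original-suc Q))
                   (++-assoc P (e ∷ []) Q)

    A : List (List E)
    A = greedy candidates

    A-compatible : Compatible A
    A-compatible = greedy-compatible candidates

    A-clique : IsClique G F A
    A-clique = tabulate (λ R∈A → proj₁ (lookup (proj₁ A-compatible) R∈A)) , proj₂ A-compatible

    Φ⊆B : ∀ {p} → p ∈ Φ G e A → p ∈ B
    Φ⊆B p∈ with ∈Φ⁻ p∈
    ... | R , R∈A , p∈φR = lookup (proj₂ (lookup (proj₁ A-compatible) R∈A)) p∈φR

    saturated : Saturated A B
    saturated Z wZ Z-coherent Z-pieces-coherent =
      greedy-maximal candidates Z (candidates-complete Z-pieces) Z-pieces Z-coherent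
      where
      Z-pieces : PiecesIn Z
      Z-pieces = wZ , tabulate (λ p∈ → OM.maximal-absorbs B-max (piece-walk wZ p∈) (Z-pieces-coherent _ p∈))

    B⊆ΦA : ∀ {Y} → Y ∈ B → Y ∈ Φ G e A
    B⊆ΦA = covered-by-Φ A A-clique B B-clique Φ⊆B saturated

    A-maximal : ∀ A′ → IsClique G F A′ → (∀ {R} → R ∈ A → R ∈ A′) → ∀ {Z} → Z ∈ A′ → Z ∈ A
    A-maximal A′ (A′-routes , A′-coherent) A⊆A′ {Z} Z∈A′ = saturated Z wZ Z-coherent Z-pieces-coherent
      where
      wZ : IsRoute G Z
      wZ = lookup A′-routes Z∈A′
      Z-coherent : ∀ R → R ∈ A → Coherent G F Z R
      Z-coherent R R∈A = A′-coherent Z R Z∈A′ (A⊆A′ R∈A)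
      Z-pieces-coherent : PiecesCoherentWith B Z
      Z-pieces-coherent p p∈ Y Y∈B with ∈Φ⁻ (B⊆ΦA Y∈B)
      ... | R , R∈A , Y∈φR = φ-coherent wZ (lookup (proj₁ A-clique) R∈A) (Z-coherent R R∈A) p∈ Y∈φR

    preimage : ∃ λ A → IsMaxClique G F A × (Φ G e A ≋ B)
    preimage = A , (A-clique , A-maximal) , (Φ⊆B , B⊆ΦA)

  Φ-onto : ∀ B → IsMaxClique Gₑ F′ B → ∃ λ A → IsMaxClique G F A × (Φ G e A ≋ B)
  Φ-onto B B-max = Preimage.preimage B B-max

lemma5p1 : (G : Graph) → IsFlowGraph G → (F : Framing G) → (e : Fin (m G)) → InnerEdge G e →
  (F' : Framing (M G e)) → Inherits G F e F' →
    ((A : _) → IsMaxClique G F A → IsMaxClique (M G e) F' (Φ G e A))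
    × ((B : _) → IsMaxClique (M G e) F' B → ∃ λ A → IsMaxClique G F A × (Φ G e A ≋ B))
lemma5p1 G fg F e ie F' inh = Φ-preserves-maximality , Φ-onto
  where open SplitMaximality G fg F e ie F' inh
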